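{- Let $\mathbf{q}=(\mathbf{r},\mathbf{x})\in\mathbb{Z}_{\geq1}^n$, where $\mathbf{r}=(r_1,\ldots,r_d)$ with $r_1<r_2<\cdots<r_d$ and $d\geq 2$ (so $\mathbf{q}$ has at least two distinct entries), and $\mathbf{x}=(x_1,\ldots,x_d)\in\mathbb{Z}_{\geq1}^d$. If $\Delta_{(1,\mathbf{q})}$ is reflexive and IDP, then \[ x_i\leq r_{i+1}/r_i \quad\text{for all } i\leq d-1 .\] Further, if there exists some $j<d$ such that $r_j\nmid r_d$, then \[ x_d\leq r_j/(r_d \bmod r_j). \] Consequently, if there exists some $j<d$ with $r_j\nmid r_d$, then there are at most finitely many vectors $\mathbf{q}$ supported on $\mathbf{r}$ (i.e. of the form $(\mathbf{r},\mathbf{x})$ for some multiplicity vector $\mathbf{x}$) for which $\Delta_{(1,\mathbf{q})}$ is reflexive and IDP.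
   Context: For a weakly increasing $\mathbf{q}=(q_1,\ldots,q_n)\in\mathbb{Z}_{\geq1}^n$, $\Delta_{(1,\mathbf{q})}:=\mathrm{conv}\{\mathbf{e}_1,\ldots,\mathbf{e}_n,-\sum_{i=1}^n q_i\mathbf{e}_i\}\subset\mathbb{R}^n$, where $\mathbf{e}_i$ are the standard basis vectors. Given distinct positive integers $r_1<\cdots<r_d$ and positive integers $x_1,\ldots,x_d$, the notation $\mathbf{q}=(\mathbf{r},\mathbf{x})$ means $\mathbf{q}=(r_1,\ldots,r_1,r_2,\ldots,r_2,\ldots,r_d,\ldots,r_d)$ with $r_i$ repeated $x_i$ times; $\mathbf{r}$ is the support vector and $\mathbf{x}$ the multiplicity vector. For a lattice polytope $P\subset\mathbb{R}^n$, $\mathrm{cone}(P)$ is the nonnegative real span of the vectors $(1,\mathbf{v})\in\mathbb{R}^{n+1}$ for $\mathbf{v}$ a vertex of $P$. $P$ is IDP (has the integer decomposition property) if for every positive integer $m$ and every $(m,\mathbf{w})\in\mathrm{cone}(P)\cap\mathbb{Z}^{n+1}$ there exist $\mathbf{x}_1,\ldots,\mathbf{x}_m\in P\cap\mathbb{Z}^n$ with $(m,\mathbf{w})=\sum_i(1,\mathbf{x}_i)$. $P$ is reflexive if, after translation by an integer vector, the origin lies in the interior of $P$ and the polar dual of $P$ is a lattice polytope. -}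

module Defs where

open import Data.Nat as ℕ using (ℕ; zero; suc)
open import Data.Nat.DivMod using (_%_)
open import Data.Integer as ℤ using (ℤ; +_)
open import Data.Rational as ℚ using (ℚ; 0ℚ; 1ℚ)
open import Data.Fin as Fin using (Fin; zero; suc)
open import Data.List as List using (List; []; _∷_; length; lookup; replicate; concatMap; tabulate)
open import Data.Product using (Σ; ∃; _×_)
open import Data.Bool using (if_then_else_)
open import Relation.Nullary using (does)
open import Relation.Binary.PropositionalEquality using (_≡_)
open import Function.Bundles using (_⇔_)

ℤVec : ℕ → Set
ℤVec n = Fin n → ℤ

ℚVec : ℕ → Set
ℚVec n = Fin n → ℚ

toℚVec : ∀ {n} → ℤVec n → ℚVec n
toℚVec v i = ℚ._/_ (v i) 1

sumℚ : ∀ {k} → (Fin k → ℚ) → ℚ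
sumℚ {zero} f = 0ℚ
sumℚ {suc k} f = f zero ℚ.+ sumℚ (λ j → f (suc j))

sumℤ : ∀ {k} → (Fin k → ℤ) → ℤ
sumℤ {zero} f = + 0
sumℤ {suc k} f = f zero ℤ.+ sumℤ (λ j → f (suc j))

dot : ∀ {n} → ℚVec n → ℚVec n → ℚ
dot x y = sumℚ (λ i → x i ℚ.* y i)

-- A lattice polytope given by a finite list of generating lattice points
-- V : Fin k → ℤ^n ; P = conv(V).  Points are taken with rational coordinates.
InConv : ∀ {k n} → (Fin k → ℤVec n) → ℚVec n → Set
InConv {k} {n} V y =
  Σ (Fin k → ℚ) λ λs →
    (∀ j → 0ℚ ℚ.≤ λs j) × (sumℚ λs ≡ 1ℚ) ×
    (∀ i → y i ≡ sumℚ (λ j → λs j ℚ.* toℚVec (V j) i))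

LatticePt : ∀ {k n} → (Fin k → ℤVec n) → ℤVec n → Set
LatticePt V x = InConv V (toℚVec x)

-- (m , w) ∈ cone(P) : nonnegative combination of the vectors (1 , v_j)
InCone : ∀ {k n} → (Fin k → ℤVec n) → ℤ → ℤVec n → Set
InCone {k} {n} V m w =
  Σ (Fin k → ℚ) λ λs →
    (∀ j → 0ℚ ℚ.≤ λs j) × (sumℚ λs ≡ ℚ._/_ m 1) ×
    (∀ i → ℚ._/_ (w i) 1 ≡ sumℚ (λ j → λs j ℚ.* toℚVec (V j) i))

IDP : ∀ {k n} → (Fin k → ℤVec n) → Set
IDP {k} {n} V =
  ∀ (m : ℕ) → 1 ℕ.≤ m → (w : ℤVec n) → InCone V (+ m) w →
    Σ (Fin m → ℤVec n) λ xs →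
      (∀ j → LatticePt V (xs j)) × (∀ i → w i ≡ sumℤ (λ j → xs j i))

translate : ∀ {k n} → (Fin k → ℤVec n) → ℤVec n → (Fin k → ℤVec n)
translate V t j i = V j i ℤ.- t i

OriginInInterior : ∀ {k n} → (Fin k → ℤVec n) → Set
OriginInInterior {k} {n} V =
  Σ ℚ λ ε → (0ℚ ℚ.< ε) × (∀ (y : ℚVec n) → (∀ i → ℚ.∣ y i ∣ ℚ.≤ ε) → InConv V y)

InPolar : ∀ {k n} → (Fin k → ℤVec n) → ℚVec n → Set
InPolar V y = ∀ x → InConv V x → dot x y ℚ.≤ 1ℚ

IsLatticePolytope : ∀ {n} → (ℚVec n → Set) → Set
IsLatticePolytope {n} S =
  Σ ℕ λ l → Σ (Fin l → ℤVec n) λ L → ∀ y → S y ⇔ InConv L y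

Reflexive : ∀ {k n} → (Fin k → ℤVec n) → Set
Reflexive {k} {n} V =
  Σ (ℤVec n) λ t →
    OriginInInterior (translate V t) × IsLatticePolytope (InPolar (translate V t))

-- vertices of Δ_(1,q) : index 0 ↦ -q , index (suc k) ↦ e_k
simplexV : (q : List ℕ) → Fin (suc (length q)) → ℤVec (length q)
simplexV q zero i = ℤ.- (+ lookup q i)
simplexV q (suc k) i = if does (k Fin.≟ i) then + 1 else + 0

-- q = (r , x) : r_i repeated x_i times, in order
qOf : ∀ {d} → (Fin d → ℕ) → (Fin d → ℕ) → List ℕ
qOf {d} r x = concatMap (λ i → replicate (x i) (r i)) (tabulate {n = d} (λ i → i))

ReflexiveIDP : List ℕ → Set
ReflexiveIDP q = Reflexive (simplexV q) × IDP (simplexV q)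

-- remainder, with r mod 0 := r (only used for positive moduli)
_mod_ : ℕ → ℕ → ℕ
a mod zero = a
a mod suc b = a % suc b

-- Let b = 1 + Σ q_i. Reflexivity of Δ(1,q) forces q_p ∣ b for every p: after the
-- translation by t, the facets of Δ opposite -q and opposite e_p are supported by
-- lattice points of the polar, and evaluating these on the vertices shows first
-- Σ t = 0 and then b = q_p K. Given r = q_p ∣ b, apply the IDP to the cone point
-- (K - D, -⌊q/r⌋) with D = Σ ⌊q_i/r⌋: some summand has a negative p-th coordinate,
-- which forces its height 1 - Σ x to be all of K and its coordinates to be at least
-- -⌊q_i/r⌋; hence K - D ≤ 1, that is Σ (q_i mod r) < r. Since r_i occurs x_i times
-- in q, this yields x_i (r_i mod r_j) < r_j for all i and j, which contains both
-- bounds, and all multiplicities are at most r_d.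

module Submission where

open import Defs
open import Algebra.Bundles using (CommutativeRing)
open import Data.Bool using (true; false; if_then_else_)
open import Data.Empty using (⊥-elim)
open import Data.Fin as Fin using (Fin; zero; suc; toℕ; fromℕ; fromℕ<)
import Data.Fin.Properties as FinP
open import Data.Integer as ℤ using (ℤ; +_; -[1+_])
import Data.Integer.Properties as ℤP
open import Data.Integer.Tactic.RingSolver using (solve-∀)
open import Data.List using (List; []; _∷_; _++_; length; lookup; map; concat; replicate)
open import Data.List.Membership.Propositional using (_∈_)
open import Data.List.Membership.Propositional.Properties using (∈-map⁺; ∈-tabulate⁺; ∈-concat⁺′)
open import Data.List.Properties using (map-++)
open import Data.List.Relation.Unary.All as All using (All)
import Data.List.Relation.Unary.All.Properties as AllP
open import Data.List.Relation.Unary.Any as Any using (here; there)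
import Data.List.Relation.Unary.Any.Properties as AnyP
open import Data.Nat as ℕ using (ℕ; zero; suc)
import Data.Nat.Coprimality as Coprime
open import Data.Nat.DivMod using (m≡m%n+[m/n]*n; m%n<n; n/n≡1; m<n⇒m%n≡m)
open import Data.Nat.Divisibility using (_∣_; m%n≡0⇒n∣m)
import Data.Nat.Properties as ℕP
open import Data.Product using (Σ; ∃; _×_; _,_; proj₁; proj₂)
open import Data.Rational as ℚ using (ℚ; mkℚ; 0ℚ; 1ℚ)
import Data.Rational.Properties as ℚP
open import Data.Rational.Solver using (module +-*-Solver)
open import Data.Sum using (inj₁; inj₂)
open import Function using (_∘_)
open import Function.Bundles using (Equivalence; _⇔_)
open import Relation.Binary.PropositionalEquality
  using (_≡_; _≢_; refl; sym; trans; cong; cong₂; subst; subst₂; module ≡-Reasoning)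
open import Relation.Nullary using (¬_; does; yes; no)

ι : ℤ → ℚ
ι i = i ℚ./ 1

private
  ι≡mkℚ : ∀ i → ι i ≡ mkℚ i 0 (Coprime.sym (Coprime.1-coprimeTo ℤ.∣ i ∣))
  ι≡mkℚ i = ℚP.↥p/↧p≡p (mkℚ i 0 _)

ι-homo-+ : ∀ i j → ι (i ℤ.+ j) ≡ ι i ℚ.+ ι j
ι-homo-+ i j = begin
  ι (i ℤ.+ j)                     ≡⟨ cong₂ (λ u v → (u ℤ.+ v) ℚ./ 1) (ℤP.*-identityʳ i) (ℤP.*-identityʳ j) ⟨
  (i ℤ.* + 1 ℤ.+ j ℤ.* + 1) ℚ./ 1 ≡⟨ cong₂ ℚ._+_ (ι≡mkℚ i) (ι≡mkℚ j) ⟨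
  ι i ℚ.+ ι j                     ∎
  where open ≡-Reasoning

ι-homo-* : ∀ i j → ι (i ℤ.* j) ≡ ι i ℚ.* ι j
ι-homo-* i j = sym (cong₂ ℚ._*_ (ι≡mkℚ i) (ι≡mkℚ j))

ι-homo-neg : ∀ i → ι (ℤ.- i) ≡ ℚ.- ι i
ι-homo-neg (+ 0)     = refl
ι-homo-neg (+ suc n) = trans (ι≡mkℚ (ℤ.- + suc n)) (cong ℚ.-_ (sym (ι≡mkℚ (+ suc n))))
ι-homo-neg -[1+ n ]  = trans (ι≡mkℚ (+ suc n)) (cong ℚ.-_ (sym (ι≡mkℚ -[1+ n ])))

ι-mono-≤ : ∀ {i j} → i ℤ.≤ j → ι i ℚ.≤ ι j
ι-mono-≤ {i} {j} i≤j rewrite ι≡mkℚ i | ι≡mkℚ j =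
  ℚ.*≤* (subst₂ ℤ._≤_ (sym (ℤP.*-identityʳ i)) (sym (ℤP.*-identityʳ j)) i≤j)

ι-cancel-≤ : ∀ {i j} → ι i ℚ.≤ ι j → i ℤ.≤ j
ι-cancel-≤ {i} {j} ιi≤ιj rewrite ι≡mkℚ i | ι≡mkℚ j with ιi≤ιj
... | ℚ.*≤* i≤j = subst₂ ℤ._≤_ (ℤP.*-identityʳ i) (ℤP.*-identityʳ j) i≤j

ι-mono-< : ∀ {i j} → i ℤ.< j → ι i ℚ.< ι j
ι-mono-< {i} {j} i<j rewrite ι≡mkℚ i | ι≡mkℚ j =
  ℚ.*<* (subst₂ ℤ._<_ (sym (ℤP.*-identityʳ i)) (sym (ℤP.*-identityʳ j)) i<j)

p≤q⇒0≤q-p : ∀ {p q} → p ℚ.≤ q → 0ℚ ℚ.≤ q ℚ.- p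
p≤q⇒0≤q-p {p} {q} p≤q = subst (ℚ._≤ q ℚ.- p) (ℚP.+-inverseʳ p) (ℚP.+-monoˡ-≤ (ℚ.- p) p≤q)

p-q≤0⇒p≤q : ∀ {p q} → p ℚ.- q ℚ.≤ 0ℚ → p ℚ.≤ q
p-q≤0⇒p≤q {p} {q} p-q≤0 = subst₂ ℚ._≤_ (minus-plus p q) (ℚP.+-identityˡ q) (ℚP.+-monoˡ-≤ q p-q≤0)
  where
  open +-*-Solver
  minus-plus : ∀ p q → p ℚ.- q ℚ.+ q ≡ p
  minus-plus = solve 2 (λ p q → p :- q :+ q := p) refl

p+q≡r⇒p≡r-q : ∀ {p q r} → p ℚ.+ q ≡ r → p ≡ r ℚ.- q
p+q≡r⇒p≡r-q {p} {q} refl = plus-minus p q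
  where
  open +-*-Solver
  plus-minus : ∀ p q → p ≡ p ℚ.+ q ℚ.- q
  plus-minus = solve 2 (λ p q → p := p :+ q :- q) refl

p+q≤r⇒p≤r-q : ∀ {p q r} → p ℚ.+ q ℚ.≤ r → p ℚ.≤ r ℚ.- q
p+q≤r⇒p≤r-q {p} {q} {r} p+q≤r =
  subst (ℚ._≤ r ℚ.- q) (sym (p+q≡r⇒p≡r-q refl)) (ℚP.+-monoˡ-≤ (ℚ.- q) p+q≤r)

0≤q⇒p-q≤p : ∀ {p q} → 0ℚ ℚ.≤ q → p ℚ.- q ℚ.≤ p
0≤q⇒p-q≤p {p} {q} 0≤q = subst (p ℚ.- q ℚ.≤_) (ℚP.+-identityʳ p) (ℚP.+-monoʳ-≤ p (ℚP.neg-antimono-≤ 0≤q))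

*-nonNegℚ : ∀ {p q} → 0ℚ ℚ.≤ p → 0ℚ ℚ.≤ q → 0ℚ ℚ.≤ p ℚ.* q
*-nonNegℚ {p} {q} 0≤p 0≤q =
  ℚP.nonNegative⁻¹ _ {{ℚP.nonNeg*nonNeg⇒nonNeg p {{ℚ.nonNegative 0≤p}} q {{ℚ.nonNegative 0≤q}}}}

-- Finite sums

module FiniteSum {c ℓ} (R : CommutativeRing c ℓ) where

  open CommutativeRing R hiding (zero)
    renaming (refl to ≈-refl; sym to ≈-sym; trans to ≈-trans)

  δ : ∀ {n} → Fin n → Fin n → Carrier
  δ k i = if does (k Fin.≟ i) then 1# else 0#

  δ-sym : ∀ {n} (k i : Fin n) → δ k i ≡ δ i k
  δ-sym k i with k Fin.≟ i | i Fin.≟ k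
  ... | yes _   | yes _   = refl
  ... | no _    | no _    = refl
  ... | yes k≡i | no i≢k  = ⊥-elim (i≢k (sym k≡i))
  ... | no k≢i  | yes i≡k = ⊥-elim (k≢i (sym i≡k))

  δ-diag : ∀ {n} (k : Fin n) → δ k k ≡ 1#
  δ-diag k with k Fin.≟ k
  ... | yes _  = refl
  ... | no k≢k = ⊥-elim (k≢k refl)

  δ-≢ : ∀ {n} {k i : Fin n} → k ≢ i → δ k i ≡ 0#
  δ-≢ {k = k} {i} k≢i with k Fin.≟ i
  ... | yes k≡i = ⊥-elim (k≢i k≡i)
  ... | no _    = refl

  module Sum (Σ : ∀ {k} → (Fin k → Carrier) → Carrier)
             (Σ-[] : (f : Fin 0 → Carrier) → Σ f ≈ 0#)
             (Σ-∷ : ∀ {k} (f : Fin (suc k) → Carrier) → Σ f ≈ f zero + Σ (f ∘ suc))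
             where

    open import Algebra.Properties.AbelianGroup +-abelianGroup using (⁻¹-∙-comm; ε⁻¹≈ε)
    open import Algebra.Properties.CommutativeSemigroup +-commutativeSemigroup using (interchange)
    open import Relation.Binary.Reasoning.Setoid setoid

    sum-cong : ∀ {k} {f g : Fin k → Carrier} → (∀ i → f i ≈ g i) → Σ f ≈ Σ g
    sum-cong {zero} {f} {g} f≈g = ≈-trans (Σ-[] f) (≈-sym (Σ-[] g))
    sum-cong {suc k} {f} {g} f≈g = begin
      Σ f                  ≈⟨ Σ-∷ f ⟩
      f zero + Σ (f ∘ suc) ≈⟨ +-cong (f≈g zero) (sum-cong (f≈g ∘ suc)) ⟩
      g zero + Σ (g ∘ suc) ≈⟨ Σ-∷ g ⟨
      Σ g                  ∎

    sum-0# : ∀ {k} → Σ {k} (λ _ → 0#) ≈ 0#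
    sum-0# {zero}  = Σ-[] _
    sum-0# {suc k} = ≈-trans (Σ-∷ _) (≈-trans (+-congˡ (sum-0# {k})) (+-identityʳ 0#))

    sum-+ : ∀ {k} (f g : Fin k → Carrier) → Σ (λ i → f i + g i) ≈ Σ f + Σ g
    sum-+ {zero} f g =
      ≈-trans (Σ-[] _) (≈-sym (≈-trans (+-cong (Σ-[] f) (Σ-[] g)) (+-identityʳ 0#)))
    sum-+ {suc k} f g = begin
      Σ (λ i → f i + g i)                                 ≈⟨ Σ-∷ _ ⟩
      (f zero + g zero) + Σ (λ i → f (suc i) + g (suc i)) ≈⟨ +-congˡ (sum-+ (f ∘ suc) (g ∘ suc)) ⟩
      (f zero + g zero) + (Σ (f ∘ suc) + Σ (g ∘ suc))     ≈⟨ interchange _ _ _ _ ⟩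
      (f zero + Σ (f ∘ suc)) + (g zero + Σ (g ∘ suc))     ≈⟨ +-cong (Σ-∷ f) (Σ-∷ g) ⟨
      Σ f + Σ g                                           ∎

    *-distribˡ-sum : ∀ {k} x (f : Fin k → Carrier) → x * Σ f ≈ Σ (λ i → x * f i)
    *-distribˡ-sum {zero} x f = ≈-trans (*-congˡ (Σ-[] f)) (≈-trans (zeroʳ x) (≈-sym (Σ-[] _)))
    *-distribˡ-sum {suc k} x f = begin
      x * Σ f                              ≈⟨ *-congˡ (Σ-∷ f) ⟩
      x * (f zero + Σ (f ∘ suc))           ≈⟨ distribˡ x _ _ ⟩
      x * f zero + x * Σ (f ∘ suc)         ≈⟨ +-congˡ (*-distribˡ-sum x (f ∘ suc)) ⟩
      x * f zero + Σ (λ i → x * f (suc i)) ≈⟨ Σ-∷ _ ⟨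
      Σ (λ i → x * f i)                    ∎

    -‿distrib-sum : ∀ {k} (f : Fin k → Carrier) → - Σ f ≈ Σ (λ i → - f i)
    -‿distrib-sum {zero} f = ≈-trans (-‿cong (Σ-[] f)) (≈-trans ε⁻¹≈ε (≈-sym (Σ-[] _)))
    -‿distrib-sum {suc k} f = begin
      - Σ f                            ≈⟨ -‿cong (Σ-∷ f) ⟩
      - (f zero + Σ (f ∘ suc))         ≈⟨ ⁻¹-∙-comm _ _ ⟨
      - f zero + - Σ (f ∘ suc)         ≈⟨ +-congˡ (-‿distrib-sum (f ∘ suc)) ⟩
      - f zero + Σ (λ i → - f (suc i)) ≈⟨ Σ-∷ _ ⟨
      Σ (λ i → - f i)                  ∎

    sum-comm : ∀ {k l} (f : Fin k → Fin l → Carrier) →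
               Σ (λ i → Σ (f i)) ≈ Σ (λ j → Σ (λ i → f i j))
    sum-comm {zero} f = ≈-trans (Σ-[] _) (≈-trans (≈-sym sum-0#) (sum-cong (λ j → ≈-sym (Σ-[] _))))
    sum-comm {suc k} f = begin
      Σ (λ i → Σ (f i))                            ≈⟨ Σ-∷ _ ⟩
      Σ (f zero) + Σ (λ i → Σ (f (suc i)))         ≈⟨ +-congˡ (sum-comm (f ∘ suc)) ⟩
      Σ (f zero) + Σ (λ j → Σ (λ i → f (suc i) j)) ≈⟨ sum-+ (f zero) _ ⟨
      Σ (λ j → f zero j + Σ (λ i → f (suc i) j))   ≈⟨ sum-cong (λ j → ≈-sym (Σ-∷ (λ i → f i j))) ⟩
      Σ (λ j → Σ (λ i → f i j))                    ∎

    sum-δ : ∀ {n} (k : Fin n) (f : Fin n → Carrier) → Σ (λ i → δ k i * f i) ≈ f k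
    sum-δ {suc n} zero f = begin
      Σ (λ i → δ zero i * f i)               ≈⟨ Σ-∷ _ ⟩
      1# * f zero + Σ (λ i → 0# * f (suc i)) ≈⟨ +-cong (*-identityˡ _) (sum-cong (zeroˡ ∘ f ∘ suc)) ⟩
      f zero + Σ (λ _ → 0#)                  ≈⟨ +-congˡ sum-0# ⟩
      f zero + 0#                            ≈⟨ +-identityʳ _ ⟩
      f zero                                 ∎
    sum-δ {suc n} (suc k) f = begin
      Σ (λ i → δ (suc k) i * f i)                           ≈⟨ Σ-∷ _ ⟩
      0# * f zero + Σ (λ i → δ (suc k) (suc i) * f (suc i)) ≈⟨ +-cong (zeroˡ _) (sum-cong δ-suc) ⟩
      0# + Σ (λ i → δ k i * f (suc i))                      ≈⟨ +-identityˡ _ ⟩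
      Σ (λ i → δ k i * f (suc i))                           ≈⟨ sum-δ k (f ∘ suc) ⟩
      f (suc k)                                             ∎
      where
      δ-suc : ∀ i → δ (suc k) (suc i) * f (suc i) ≈ δ k i * f (suc i)
      δ-suc i with k Fin.≟ i
      ... | yes _ = ≈-refl
      ... | no _  = ≈-refl

    sum-δ≈1# : ∀ {n} (k : Fin n) → Σ (δ k) ≈ 1#
    sum-δ≈1# k = ≈-trans (sum-cong (λ i → ≈-sym (*-identityʳ (δ k i)))) (sum-δ k (λ _ → 1#))

sumℚ-[] : (f : Fin 0 → ℚ) → sumℚ f ≡ 0ℚ
sumℚ-[] _ = refl

sumℚ-∷ : ∀ {k} (f : Fin (suc k) → ℚ) → sumℚ f ≡ f zero ℚ.+ sumℚ (f ∘ suc)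
sumℚ-∷ _ = refl

sumℤ-[] : (f : Fin 0 → ℤ) → sumℤ f ≡ + 0
sumℤ-[] _ = refl

sumℤ-∷ : ∀ {k} (f : Fin (suc k) → ℤ) → sumℤ f ≡ f zero ℤ.+ sumℤ (f ∘ suc)
sumℤ-∷ _ = refl

module Σℚ = FiniteSum.Sum ℚP.+-*-commutativeRing sumℚ sumℚ-[] sumℚ-∷
module Σℤ = FiniteSum.Sum ℤP.+-*-commutativeRing sumℤ sumℤ-[] sumℤ-∷
open FiniteSum ℚP.+-*-commutativeRing using () renaming (δ to δℚ; δ-sym to δℚ-sym; δ-diag to δℚ-diag; δ-≢ to δℚ-≢)
open FiniteSum ℤP.+-*-commutativeRing using () renaming (δ to δℤ)

ι-sum : ∀ {k} (f : Fin k → ℤ) → ι (sumℤ f) ≡ sumℚ (ι ∘ f)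
ι-sum {zero}  f = refl
ι-sum {suc k} f = trans (ι-homo-+ (f zero) _) (cong (ι (f zero) ℚ.+_) (ι-sum (f ∘ suc)))

ι-δ : ∀ {n} (k i : Fin n) → ι (δℤ k i) ≡ δℚ k i
ι-δ k i with does (k Fin.≟ i)
... | true  = refl
... | false = refl

sumℚ-nonNeg : ∀ {k} (f : Fin k → ℚ) → (∀ i → 0ℚ ℚ.≤ f i) → 0ℚ ℚ.≤ sumℚ f
sumℚ-nonNeg {zero}  f f≥0 = ℚP.≤-refl
sumℚ-nonNeg {suc k} f f≥0 = ℚP.+-mono-≤ (f≥0 zero) (sumℚ-nonNeg (f ∘ suc) (f≥0 ∘ suc))

≤-sumℚ : ∀ {k} (f : Fin k → ℚ) → (∀ i → 0ℚ ℚ.≤ f i) → ∀ j → f j ℚ.≤ sumℚ f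
≤-sumℚ f f≥0 zero = subst (ℚ._≤ sumℚ f) (ℚP.+-identityʳ (f zero))
  (ℚP.+-monoʳ-≤ (f zero) (sumℚ-nonNeg (f ∘ suc) (f≥0 ∘ suc)))
≤-sumℚ f f≥0 (suc j) = ℚP.≤-trans (≤-sumℚ (f ∘ suc) (f≥0 ∘ suc) j)
  (subst (ℚ._≤ sumℚ f) (ℚP.+-identityˡ _) (ℚP.+-monoˡ-≤ (sumℚ (f ∘ suc)) (f≥0 zero)))

sumℚ-pos⇒∃pos : ∀ {k} (f : Fin k → ℚ) → 0ℚ ℚ.< sumℚ f → ∃ λ j → 0ℚ ℚ.< f j
sumℚ-pos⇒∃pos {zero}  f 0<0 = ⊥-elim (ℚP.<-irrefl refl 0<0)
sumℚ-pos⇒∃pos {suc k} f 0<Σf with 0ℚ ℚP.<? f zero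
... | yes 0<f₀ = zero , 0<f₀
... | no 0≮f₀ with sumℚ-pos⇒∃pos (f ∘ suc) (ℚP.<-≤-trans 0<Σf Σf≤Σtail)
  where
  Σf≤Σtail : sumℚ f ℚ.≤ sumℚ (f ∘ suc)
  Σf≤Σtail = ℚP.≤-trans (ℚP.+-monoˡ-≤ _ (ℚP.≮⇒≥ 0≮f₀)) (ℚP.≤-reflexive (ℚP.+-identityˡ _))
...   | j , 0<fj = suc j , 0<fj

sumℤ-const1 : ∀ k → sumℤ {k} (λ _ → + 1) ≡ + k
sumℤ-const1 zero    = refl
sumℤ-const1 (suc k) = trans (cong (λ s → + 1 ℤ.+ s) (sumℤ-const1 k)) (sym (ℤP.pos-+ 1 k))

sumℤ-mono-≤ : ∀ {k} {f g : Fin k → ℤ} → (∀ i → f i ℤ.≤ g i) → sumℤ f ℤ.≤ sumℤ g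
sumℤ-mono-≤ {zero}  f≤g = ℤP.≤-refl
sumℤ-mono-≤ {suc k} f≤g = ℤP.+-mono-≤ (f≤g zero) (sumℤ-mono-≤ (f≤g ∘ suc))

sumℤ-nonNeg : ∀ {k} {f : Fin k → ℤ} → (∀ i → + 0 ℤ.≤ f i) → + 0 ℤ.≤ sumℤ f
sumℤ-nonNeg {k} {f} f≥0 = subst (ℤ._≤ sumℤ f) (Σℤ.sum-0# {k}) (sumℤ-mono-≤ f≥0)

≤-sumℤ : ∀ {k} {f : Fin k → ℤ} → (∀ i → + 0 ℤ.≤ f i) → ∀ j → f j ℤ.≤ sumℤ f
≤-sumℤ {f = f} f≥0 zero = subst (ℤ._≤ sumℤ f) (ℤP.+-identityʳ (f zero))
  (ℤP.+-monoʳ-≤ (f zero) (sumℤ-nonNeg (f≥0 ∘ suc)))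
≤-sumℤ {f = f} f≥0 (suc j) = ℤP.≤-trans (≤-sumℤ (f≥0 ∘ suc) j)
  (subst (ℤ._≤ sumℤ f) (ℤP.+-identityˡ _) (ℤP.+-monoˡ-≤ (sumℤ (f ∘ suc)) (f≥0 zero)))

sumℤ-neg⇒∃neg : ∀ {k} (f : Fin k → ℤ) → sumℤ f ℤ.< + 0 → ∃ λ j → f j ℤ.< + 0
sumℤ-neg⇒∃neg {zero}  f (ℤ.+<+ ())
sumℤ-neg⇒∃neg {suc k} f Σf<0 with f zero ℤP.<? + 0
... | yes f₀<0 = zero , f₀<0
... | no f₀≮0 with sumℤ-neg⇒∃neg (f ∘ suc) (ℤP.≤-<-trans Σtail≤Σf Σf<0)
  where
  Σtail≤Σf : sumℤ (f ∘ suc) ℤ.≤ sumℤ f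
  Σtail≤Σf = ℤP.≤-trans (ℤP.≤-reflexive (sym (ℤP.+-identityˡ _))) (ℤP.+-monoˡ-≤ _ (ℤP.≮⇒≥ f₀≮0))
...   | j , fj<0 = suc j , fj<0

-- Lattice polytopes, their translates and polar duals

dotℤ : ∀ {n} → ℤVec n → ℤVec n → ℤ
dotℤ a b = sumℤ (λ i → a i ℤ.* b i)

dot-toℚVec : ∀ {n} (a b : ℤVec n) → dot (toℚVec a) (toℚVec b) ≡ ι (dotℤ a b)
dot-toℚVec a b = sym (trans (ι-sum (λ i → a i ℤ.* b i)) (Σℚ.sum-cong (λ i → ι-homo-* (a i) (b i))))

dotℤ-translate : ∀ {k n} (V : Fin k → ℤVec n) (t : ℤVec n) j (y : ℤVec n) →
  dotℤ (translate V t j) y ≡ dotℤ (V j) y ℤ.- dotℤ t y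
dotℤ-translate V t j y = begin
  sumℤ (λ i → (V j i ℤ.- t i) ℤ.* y i)
    ≡⟨ Σℤ.sum-cong (λ i → distrib (V j i) (t i) (y i)) ⟩
  sumℤ (λ i → V j i ℤ.* y i ℤ.+ ℤ.- (t i ℤ.* y i))
    ≡⟨ Σℤ.sum-+ (λ i → V j i ℤ.* y i) (λ i → ℤ.- (t i ℤ.* y i)) ⟩
  dotℤ (V j) y ℤ.+ sumℤ (λ i → ℤ.- (t i ℤ.* y i))
    ≡⟨ cong (λ s → dotℤ (V j) y ℤ.+ s) (Σℤ.-‿distrib-sum (λ i → t i ℤ.* y i)) ⟨
  dotℤ (V j) y ℤ.- dotℤ t y ∎
  where
  open ≡-Reasoning
  distrib : ∀ v s x → (v ℤ.- s) ℤ.* x ≡ v ℤ.* x ℤ.+ ℤ.- (s ℤ.* x)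
  distrib = solve-∀

dot-distribʳ-+ : ∀ {n} (x y a : ℚVec n) → dot (λ i → x i ℚ.+ y i) a ≡ dot x a ℚ.+ dot y a
dot-distribʳ-+ x y a =
  trans (Σℚ.sum-cong (λ i → ℚP.*-distribʳ-+ (a i) (x i) (y i)))
        (Σℚ.sum-+ (λ i → x i ℚ.* a i) (λ i → y i ℚ.* a i))

dot-scaleʳ : ∀ {n} (c : ℚ) (x a : ℚVec n) → dot x (λ i → c ℚ.* a i) ≡ c ℚ.* dot x a
dot-scaleʳ c x a = trans (Σℚ.sum-cong x-c-a) (sym (Σℚ.*-distribˡ-sum c (λ i → x i ℚ.* a i)))
  where
  x-c-a : ∀ i → x i ℚ.* (c ℚ.* a i) ≡ c ℚ.* (x i ℚ.* a i)
  x-c-a i = trans (sym (ℚP.*-assoc (x i) c (a i)))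
    (trans (cong (ℚ._* a i) (ℚP.*-comm (x i) c)) (ℚP.*-assoc c (x i) (a i)))

dot-combinationʳ : ∀ {n l} (x : ℚVec n) (μ : Fin l → ℚ) (v : Fin l → ℚVec n) →
  dot x (λ i → sumℚ (λ m → μ m ℚ.* v m i)) ≡ sumℚ (λ m → μ m ℚ.* dot x (v m))
dot-combinationʳ x μ v = begin
  sumℚ (λ i → x i ℚ.* sumℚ (λ m → μ m ℚ.* v m i))
    ≡⟨ Σℚ.sum-cong (λ i → Σℚ.*-distribˡ-sum (x i) (λ m → μ m ℚ.* v m i)) ⟩
  sumℚ (λ i → sumℚ (λ m → x i ℚ.* (μ m ℚ.* v m i))) ≡⟨ Σℚ.sum-comm (λ i m → x i ℚ.* (μ m ℚ.* v m i)) ⟩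
  sumℚ (λ m → sumℚ (λ i → x i ℚ.* (μ m ℚ.* v m i))) ≡⟨ Σℚ.sum-cong (λ m → dot-scaleʳ (μ m) x (v m)) ⟩
  sumℚ (λ m → μ m ℚ.* dot x (v m))                  ∎
  where open ≡-Reasoning

vertex∈conv : ∀ {k n} (V : Fin k → ℤVec n) (j : Fin k) → InConv V (toℚVec (V j))
vertex∈conv V j = (λ m → δℚ m j) , δ≥0 , Σδ≡1 , coordinate
  where
  δ≥0 : ∀ m → 0ℚ ℚ.≤ δℚ m j
  δ≥0 m with does (m Fin.≟ j)
  ... | true  = ℚP.nonNegative⁻¹ 1ℚ
  ... | false = ℚP.≤-refl
  Σδ≡1 : sumℚ (λ m → δℚ m j) ≡ 1ℚ
  Σδ≡1 = trans (Σℚ.sum-cong (λ m → δℚ-sym m j)) (Σℚ.sum-δ≈1# j)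
  coordinate : ∀ i → toℚVec (V j) i ≡ sumℚ (λ m → δℚ m j ℚ.* toℚVec (V m) i)
  coordinate i = sym (trans (Σℚ.sum-cong (λ m → cong (ℚ._* toℚVec (V m) i) (δℚ-sym m j)))
                            (Σℚ.sum-δ j (λ m → toℚVec (V m) i)))

toℚVec-translate : ∀ {k n} (V : Fin k → ℤVec n) (t : ℤVec n) j i →
  toℚVec (translate V t j) i ℚ.+ ι (t i) ≡ toℚVec (V j) i
toℚVec-translate V t j i =
  trans (sym (ι-homo-+ (V j i ℤ.- t i) (t i))) (cong ι (minus-plus (V j i) (t i)))
  where
  minus-plus : ∀ a b → a ℤ.- b ℤ.+ b ≡ a
  minus-plus = solve-∀

InConv-translate : ∀ {k n} (V : Fin k → ℤVec n) (t : ℤVec n) {y : ℚVec n} →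
  InConv (translate V t) y → InConv V (λ i → y i ℚ.+ ι (t i))
InConv-translate V t {y} (λs , λs≥0 , Σλs≡1 , y≡) = λs , λs≥0 , Σλs≡1 , coordinate
  where
  open +-*-Solver
  coordinate : ∀ i → y i ℚ.+ ι (t i) ≡ sumℚ (λ j → λs j ℚ.* toℚVec (V j) i)
  coordinate i = begin
    y i ℚ.+ ι (t i)
      ≡⟨ cong₂ ℚ._+_ (y≡ i) (sym (trans (cong (ι (t i) ℚ.*_) Σλs≡1) (ℚP.*-identityʳ _))) ⟩
    sumℚ (λ j → λs j ℚ.* W j) ℚ.+ ι (t i) ℚ.* sumℚ λs
      ≡⟨ cong (sumℚ (λ j → λs j ℚ.* W j) ℚ.+_) (Σℚ.*-distribˡ-sum (ι (t i)) λs) ⟩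
    sumℚ (λ j → λs j ℚ.* W j) ℚ.+ sumℚ (λ j → ι (t i) ℚ.* λs j)
      ≡⟨ Σℚ.sum-+ (λ j → λs j ℚ.* W j) (λ j → ι (t i) ℚ.* λs j) ⟨
    sumℚ (λ j → λs j ℚ.* W j ℚ.+ ι (t i) ℚ.* λs j)
      ≡⟨ Σℚ.sum-cong (λ j → trans (distrib (λs j) (W j) (ι (t i))) (cong (λs j ℚ.*_) (toℚVec-translate V t j i))) ⟩
    sumℚ (λ j → λs j ℚ.* toℚVec (V j) i) ∎
    where
    open ≡-Reasoning
    W : Fin _ → ℚ
    W j = toℚVec (translate V t j) i
    distrib : ∀ l w s → l ℚ.* w ℚ.+ s ℚ.* l ≡ l ℚ.* (w ℚ.+ s)
    distrib = solve 3 (λ l w s → l :* w :+ s :* l := l :* (w :+ s)) refl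

module PolarOfLatticePolytope {k n l} (W : Fin k → ℤVec n) (L : Fin l → ℤVec n)
                              (polar⇔conv : ∀ y → InPolar W y ⇔ InConv L y) where

  dotℤ-vertex≤1 : ∀ j m → dotℤ (W j) (L m) ℤ.≤ + 1
  dotℤ-vertex≤1 j m = ι-cancel-≤ (subst (ℚ._≤ 1ℚ) (dot-toℚVec (W j) (L m))
    (Equivalence.from (polar⇔conv (toℚVec (L m))) (vertex∈conv L m) (toℚVec (W j)) (vertex∈conv W j)))

  -- u is a convex combination of the vertices L m of the polar; every constraint
  -- tight at u is tight at each vertex carrying positive weight.
  tight-vertex : ∀ u → InPolar W u →
    ∃ λ m → ∀ j → dot (toℚVec (W j)) u ≡ 1ℚ → dotℤ (W j) (L m) ≡ + 1
  tight-vertex u u∈polar with Equivalence.to (polar⇔conv u) u∈polar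
  ... | μ , μ≥0 , Σμ≡1 , u≡ with sumℚ-pos⇒∃pos μ (subst (0ℚ ℚ.<_) (sym Σμ≡1) (ℚP.positive⁻¹ 1ℚ))
  ...   | m₀ , μm₀>0 = m₀ , tight
    where
    open +-*-Solver
    tight : ∀ j → dot (toℚVec (W j)) u ≡ 1ℚ → dotℤ (W j) (L m₀) ≡ + 1
    tight j ⟨Wj,u⟩≡1 = ℤP.≤-antisym (dotℤ-vertex≤1 j m₀) (ι-cancel-≤ 1≤am₀)
      where
      a : Fin l → ℚ
      a m = ι (dotℤ (W j) (L m))
      slack : Fin l → ℚ
      slack m = μ m ℚ.* (1ℚ ℚ.- a m)
      slack≥0 : ∀ m → 0ℚ ℚ.≤ slack m
      slack≥0 m = *-nonNegℚ (μ≥0 m) (p≤q⇒0≤q-p (ι-mono-≤ (dotℤ-vertex≤1 j m)))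
      Σμa≡1 : sumℚ (λ m → μ m ℚ.* a m) ≡ 1ℚ
      Σμa≡1 = begin
        sumℚ (λ m → μ m ℚ.* a m)
          ≡⟨ Σℚ.sum-cong (λ m → cong (μ m ℚ.*_) (dot-toℚVec (W j) (L m))) ⟨
        sumℚ (λ m → μ m ℚ.* dot (toℚVec (W j)) (toℚVec (L m)))
          ≡⟨ dot-combinationʳ (toℚVec (W j)) μ (λ m → toℚVec (L m)) ⟨
        dot (toℚVec (W j)) (λ i → sumℚ (λ m → μ m ℚ.* toℚVec (L m) i))
          ≡⟨ Σℚ.sum-cong (λ i → cong (toℚVec (W j) i ℚ.*_) (u≡ i)) ⟨
        dot (toℚVec (W j)) u ≡⟨ ⟨Wj,u⟩≡1 ⟩
        1ℚ ∎
        where open ≡-Reasoning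
      Σslack≡0 : sumℚ slack ≡ 0ℚ
      Σslack≡0 = begin
        sumℚ slack
          ≡⟨ Σℚ.sum-cong (λ m → μ-μa (μ m) (a m)) ⟩
        sumℚ (λ m → μ m ℚ.+ ℚ.- (μ m ℚ.* a m))
          ≡⟨ Σℚ.sum-+ μ (λ m → ℚ.- (μ m ℚ.* a m)) ⟩
        sumℚ μ ℚ.+ sumℚ (λ m → ℚ.- (μ m ℚ.* a m))
          ≡⟨ cong (sumℚ μ ℚ.+_) (Σℚ.-‿distrib-sum (λ m → μ m ℚ.* a m)) ⟨
        sumℚ μ ℚ.- sumℚ (λ m → μ m ℚ.* a m)
          ≡⟨ cong₂ ℚ._-_ Σμ≡1 Σμa≡1 ⟩
        1ℚ ℚ.- 1ℚ ≡⟨ ℚP.+-inverseʳ 1ℚ ⟩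
        0ℚ ∎
        where
        open ≡-Reasoning
        μ-μa : ∀ x y → x ℚ.* (1ℚ ℚ.- y) ≡ x ℚ.+ ℚ.- (x ℚ.* y)
        μ-μa = solve 2 (λ x y → x :* (con 1ℚ :- y) := x :+ :- (x :* y)) refl
      1≤am₀ : 1ℚ ℚ.≤ a m₀
      1≤am₀ = p-q≤0⇒p≤q (ℚP.*-cancelˡ-≤-pos (μ m₀) {{ℚ.positive μm₀>0}}
        (subst₂ ℚ._≤_ refl (sym (ℚP.*-zeroʳ (μ m₀)))
          (subst (slack m₀ ℚ.≤_) Σslack≡0 (≤-sumℚ slack slack≥0 m₀))))

SupportingLatticeVector : ∀ {k n} → (Fin k → ℤVec n) → ℤVec n → ℚVec n → ℚ → Set
SupportingLatticeVector V t a B =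
  ∃ λ y → (∀ j → dotℤ (translate V t j) y ℤ.≤ + 1)
        × (∀ j → dot (toℚVec (V j)) a ≡ B → dotℤ (translate V t j) y ≡ + 1)

supporting-lattice-vector : ∀ {k n} (V : Fin k → ℤVec n) (t : ℤVec n) →
  IsLatticePolytope (InPolar (translate V t)) →
  (a : ℚVec n) (B : ℚ) → (∀ z → InConv V z → dot z a ℚ.≤ B) →
  (y₀ : ℚVec n) → InConv (translate V t) y₀ → 0ℚ ℚ.< dot y₀ a →
  SupportingLatticeVector V t a B
supporting-lattice-vector {k} {n} V t (l , L , polar⇔conv) a B ⟨z,a⟩≤B y₀ y₀∈conv 0<⟨y₀,a⟩ =
  L m , (λ j → dotℤ-vertex≤1 j m) , (λ j ⟨Vj,a⟩≡B → m-tight j (⟨Wj,u⟩≡1 j ⟨Vj,a⟩≡B))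
  where
  W : Fin k → ℤVec n
  W = translate V t
  open PolarOfLatticePolytope W L polar⇔conv
  D : ℚ
  D = B ℚ.- dot (toℚVec t) a

  ⟨y,a⟩≤D : ∀ y → InConv W y → dot y a ℚ.≤ D
  ⟨y,a⟩≤D y y∈conv = p+q≤r⇒p≤r-q (subst (ℚ._≤ B) (dot-distribʳ-+ y (toℚVec t) a)
    (⟨z,a⟩≤B _ (InConv-translate V t y∈conv)))

  instance
    D-positive : ℚ.Positive D
    D-positive = ℚ.positive (ℚP.<-≤-trans 0<⟨y₀,a⟩ (⟨y,a⟩≤D y₀ y₀∈conv))
    D-nonZero : ℚ.NonZero D
    D-nonZero = ℚP.pos⇒nonZero D
    D⁻¹-nonNegative : ℚ.NonNegative (ℚ.1/ D)
    D⁻¹-nonNegative = ℚP.pos⇒nonNeg (ℚ.1/ D) {{ℚP.1/pos⇒pos D}}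

  u : ℚVec n
  u i = ℚ.1/ D ℚ.* a i

  u∈polar : InPolar W u
  u∈polar y y∈conv = begin
    dot y u             ≡⟨ dot-scaleʳ (ℚ.1/ D) y a ⟩
    ℚ.1/ D ℚ.* dot y a  ≤⟨ ℚP.*-monoˡ-≤-nonNeg (ℚ.1/ D) (⟨y,a⟩≤D y y∈conv) ⟩
    ℚ.1/ D ℚ.* D        ≡⟨ ℚP.*-inverseˡ D ⟩
    1ℚ                  ∎
    where open ℚP.≤-Reasoning

  ⟨Wj,u⟩≡1 : ∀ j → dot (toℚVec (V j)) a ≡ B → dot (toℚVec (W j)) u ≡ 1ℚ
  ⟨Wj,u⟩≡1 j ⟨Vj,a⟩≡B = begin
    dot (toℚVec (W j)) u               ≡⟨ dot-scaleʳ (ℚ.1/ D) (toℚVec (W j)) a ⟩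
    ℚ.1/ D ℚ.* dot (toℚVec (W j)) a    ≡⟨ cong (ℚ.1/ D ℚ.*_) (p+q≡r⇒p≡r-q ⟨Wj,a⟩+⟨t,a⟩≡B) ⟩
    ℚ.1/ D ℚ.* D                       ≡⟨ ℚP.*-inverseˡ D ⟩
    1ℚ                                 ∎
    where
    open ≡-Reasoning
    ⟨Wj,a⟩+⟨t,a⟩≡B : dot (toℚVec (W j)) a ℚ.+ dot (toℚVec t) a ≡ B
    ⟨Wj,a⟩+⟨t,a⟩≡B = trans (sym (dot-distribʳ-+ (toℚVec (W j)) (toℚVec t) a))
      (trans (Σℚ.sum-cong (λ i → cong (ℚ._* a i) (toℚVec-translate V t j i))) ⟨Vj,a⟩≡B)

  m : Fin l
  m = proj₁ (tight-vertex u u∈polar)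

  m-tight : ∀ j → dot (toℚVec (W j)) u ≡ 1ℚ → dotℤ (W j) (L m) ≡ + 1
  m-tight = proj₂ (tight-vertex u u∈polar)

-- Integer arithmetic

i-j≡1⇒i≡1+j : ∀ {i j} → i ℤ.- j ≡ + 1 → i ≡ + 1 ℤ.+ j
i-j≡1⇒i≡1+j {i} {j} i-j≡1 = trans (split i j) (cong (ℤ._+ j) i-j≡1)
  where
  split : ∀ i j → i ≡ (i ℤ.- j) ℤ.+ j
  split = solve-∀

0≤i*j⇒0≤j : ∀ {i j} → + 0 ℤ.< i → + 0 ℤ.≤ i ℤ.* j → + 0 ℤ.≤ j
0≤i*j⇒0≤j {i} {j} 0<i 0≤ij =
  ℤP.*-cancelˡ-≤-pos (+ 0) j i {{ℤ.positive 0<i}} (subst (ℤ._≤ i ℤ.* j) (sym (ℤP.*-zeroʳ i)) 0≤ij)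

0≤i∧i*j≡1⇒j≡1 : ∀ {i j} → + 0 ℤ.≤ i → i ℤ.* j ≡ + 1 → j ≡ + 1
0≤i∧i*j≡1⇒j≡1 {+ m}     {+ n}      _ mn≡1 =
  cong +_ (ℕP.m*n≡1⇒n≡1 m n (ℤP.+-injective (trans (ℤP.pos-* m n) mn≡1)))
0≤i∧i*j≡1⇒j≡1 {+ zero}  { -[1+ n ]} _ ()
0≤i∧i*j≡1⇒j≡1 {+ suc m} { -[1+ n ]} _ ()

*-nonNegℤ : ∀ {i j} → + 0 ℤ.≤ i → + 0 ℤ.≤ j → + 0 ℤ.≤ i ℤ.* j
*-nonNegℤ {+ m} {+ n} _ _ = subst (+ 0 ℤ.≤_) (ℤP.pos-* m n) (ℤ.+≤+ ℕ.z≤n)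

multiplier≡1 : ∀ {U Q b} t → + 0 ℤ.≤ U → + 0 ℤ.< Q → Q ℤ.< b →
               U ℤ.* (Q ℤ.+ b ℤ.* t) ≡ Q → U ≡ + 1
multiplier≡1 {U} {Q} {b} (+ zero) _ 0<Q _ eq =
  ℤP.*-cancelʳ-≡ U (+ 1) Q {{ℤ.>-nonZero 0<Q}} (trans (cong (U ℤ.*_) (sym (Q+b*0≡Q Q b))) (trans eq (sym (ℤP.*-identityˡ Q))))
  where
  Q+b*0≡Q : ∀ Q b → Q ℤ.+ b ℤ.* + 0 ≡ Q
  Q+b*0≡Q = solve-∀
multiplier≡1 {+ zero} {Q} {b} (+ suc m) _ 0<Q _ eq =
  ⊥-elim (ℤP.<-irrefl (trans (sym (ℤP.*-zeroˡ (Q ℤ.+ b ℤ.* + suc m))) eq) 0<Q)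
multiplier≡1 {+ suc u} {Q} {b} (+ suc m) _ 0<Q Q<b eq = ⊥-elim (ℤP.<-irrefl (sym eq) Q<UA)
  where
  A : ℤ
  A = Q ℤ.+ b ℤ.* + suc m
  0<b : + 0 ℤ.< b
  0<b = ℤP.<-trans 0<Q Q<b
  b≤b*[1+m] : b ℤ.≤ b ℤ.* + suc m
  b≤b*[1+m] = subst (ℤ._≤ b ℤ.* + suc m) (ℤP.*-identityʳ b)
    (ℤP.*-monoˡ-≤-nonNeg b {{ℤ.nonNegative (ℤP.<⇒≤ 0<b)}} (ℤ.+≤+ (ℕ.s≤s ℕ.z≤n)))
  Q<A : Q ℤ.< A
  Q<A = subst (ℤ._< A) (ℤP.+-identityʳ Q) (ℤP.+-monoʳ-< Q (ℤP.<-≤-trans 0<b b≤b*[1+m]))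
  A≤UA : A ℤ.≤ + suc u ℤ.* A
  A≤UA = subst (A ℤ.≤_) (sym (ℤP.suc-* (+ u) A))
    (ℤP.i≤i+j A (+ u ℤ.* A) {{ℤ.nonNegative (*-nonNegℤ {+ u} (ℤ.+≤+ ℕ.z≤n) (ℤP.<⇒≤ (ℤP.<-trans 0<Q Q<A)))}})
  Q<UA : Q ℤ.< + suc u ℤ.* A
  Q<UA = ℤP.<-≤-trans Q<A A≤UA
multiplier≡1 { -[1+ u ]} (+ suc m) () _ _ _
multiplier≡1 {U} {Q} {b} -[1+ m ] 0≤U 0<Q Q<b eq = ⊥-elim (ℤP.<-irrefl eq UA<Q)
  where
  0≤b : + 0 ℤ.≤ b
  0≤b = ℤP.<⇒≤ (ℤP.<-trans 0<Q Q<b)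
  A≤0 : Q ℤ.+ b ℤ.* -[1+ m ] ℤ.≤ + 0
  A≤0 = begin
    Q ℤ.+ b ℤ.* -[1+ m ]   ≤⟨ ℤP.+-monoʳ-≤ Q (ℤP.*-monoˡ-≤-nonNeg b {{ℤ.nonNegative 0≤b}} (ℤ.-≤- ℕ.z≤n)) ⟩
    Q ℤ.+ b ℤ.* -[1+ 0 ]   ≡⟨ Q+b*-1≡Q-b Q b ⟩
    Q ℤ.- b                ≤⟨ ℤP.i≤j⇒i-j≤0 (ℤP.<⇒≤ Q<b) ⟩
    + 0                    ∎
    where
    open ℤP.≤-Reasoning
    Q+b*-1≡Q-b : ∀ Q b → Q ℤ.+ b ℤ.* -[1+ 0 ] ≡ Q ℤ.- b
    Q+b*-1≡Q-b = solve-∀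
  UA<Q : U ℤ.* (Q ℤ.+ b ℤ.* -[1+ m ]) ℤ.< Q
  UA<Q = ℤP.≤-<-trans (subst (U ℤ.* (Q ℤ.+ b ℤ.* -[1+ m ]) ℤ.≤_) (ℤP.*-zeroʳ U)
    (ℤP.*-monoˡ-≤-nonNeg U {{ℤ.nonNegative 0≤U}} A≤0)) 0<Q

dotℤ-constantʳ : ∀ {n} (g y : ℤVec n) (U : ℤ) → (∀ k → y k ≡ U) → dotℤ g y ≡ U ℤ.* sumℤ g
dotℤ-constantʳ g y U y≡U =
  trans (Σℤ.sum-cong (λ k → trans (cong (g k ℤ.*_) (y≡U k)) (ℤP.*-comm (g k) U))) (sym (Σℤ.*-distribˡ-sum U g))

dotℤ-constantʳ-except : ∀ {n} (g y : ℤVec n) (U : ℤ) (p : Fin n) → (∀ k → k ≢ p → y k ≡ U) →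
  dotℤ g y ≡ U ℤ.* sumℤ g ℤ.+ (y p ℤ.- U) ℤ.* g p
dotℤ-constantʳ-except g y U p y≡U = begin
  sumℤ (λ k → g k ℤ.* y k)
    ≡⟨ Σℤ.sum-cong (λ k → trans (cong (g k ℤ.*_) (y≡U+δv k)) (expand (g k) U (δℤ p k) v)) ⟩
  sumℤ (λ k → U ℤ.* g k ℤ.+ v ℤ.* (δℤ p k ℤ.* g k))
    ≡⟨ Σℤ.sum-+ (λ k → U ℤ.* g k) (λ k → v ℤ.* (δℤ p k ℤ.* g k)) ⟩
  sumℤ (λ k → U ℤ.* g k) ℤ.+ sumℤ (λ k → v ℤ.* (δℤ p k ℤ.* g k))
    ≡⟨ cong₂ ℤ._+_ (Σℤ.*-distribˡ-sum U g) (Σℤ.*-distribˡ-sum v (λ k → δℤ p k ℤ.* g k)) ⟨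
  U ℤ.* sumℤ g ℤ.+ v ℤ.* sumℤ (λ k → δℤ p k ℤ.* g k)
    ≡⟨ cong (λ s → U ℤ.* sumℤ g ℤ.+ v ℤ.* s) (Σℤ.sum-δ p g) ⟩
  U ℤ.* sumℤ g ℤ.+ v ℤ.* g p ∎
  where
  open ≡-Reasoning
  v : ℤ
  v = y p ℤ.- U
  expand : ∀ g U d v → g ℤ.* (U ℤ.+ d ℤ.* v) ≡ U ℤ.* g ℤ.+ v ℤ.* (d ℤ.* g)
  expand = solve-∀
  y≡U+δv : ∀ k → y k ≡ U ℤ.+ δℤ p k ℤ.* v
  y≡U+δv k with p Fin.≟ k
  ... | yes refl = split (y p) U
    where
    split : ∀ y U → y ≡ U ℤ.+ + 1 ℤ.* (y ℤ.- U)
    split = solve-∀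
  ... | no p≢k = trans (y≡U k (λ k≡p → p≢k (sym k≡p))) (pad U v)
    where
    pad : ∀ U v → U ≡ U ℤ.+ + 0 ℤ.* v
    pad = solve-∀

-- Integer content of a lattice vector y of the polar of Δ(1,Q) - t, with c = ⟨t, y⟩:
-- its values on the vertices e k - t and -Q - t are y k - c and -⟨Q, y⟩ - c.
module _ {n} (Q t y : ℤVec n) where

  private
    c U b : ℤ
    c = dotℤ t y
    U = + 1 ℤ.+ c
    b = + 1 ℤ.+ sumℤ Q

  translation-sum≡0 : + 0 ℤ.≤ sumℤ Q → (∀ k → y k ℤ.- c ≡ + 1) → ℤ.- dotℤ Q y ℤ.- c ℤ.≤ + 1 →
                      sumℤ t ≡ + 0
  translation-sum≡0 0≤ΣQ tight below = begin
    sumℤ t                         ≡⟨ double-complement (sumℤ t) ⟩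
    + 1 ℤ.- (+ 1 ℤ.- sumℤ t)       ≡⟨ cong (λ s → + 1 ℤ.- s) (0≤i∧i*j≡1⇒j≡1 0≤U U*[1-Σt]≡1) ⟩
    + 0                            ∎
    where
    open ≡-Reasoning
    double-complement : ∀ s → s ≡ + 1 ℤ.- (+ 1 ℤ.- s)
    double-complement = solve-∀
    y≡U : ∀ k → y k ≡ U
    y≡U k = i-j≡1⇒i≡1+j (tight k)
    0<b : + 0 ℤ.< b
    0<b = ℤP.<-≤-trans (ℤ.+<+ (ℕ.s≤s ℕ.z≤n)) (ℤP.i≤i+j (+ 1) (sumℤ Q) {{ℤ.nonNegative 0≤ΣQ}})
    0≤U : + 0 ℤ.≤ U
    0≤U = 0≤i*j⇒0≤j 0<b (subst (+ 0 ℤ.≤_) slack≡bU (ℤP.i≤j⇒0≤j-i below))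
      where
      rearrange : ∀ c S → + 1 ℤ.- (ℤ.- ((+ 1 ℤ.+ c) ℤ.* S) ℤ.- c) ≡ (+ 1 ℤ.+ S) ℤ.* (+ 1 ℤ.+ c)
      rearrange = solve-∀
      slack≡bU : + 1 ℤ.- (ℤ.- dotℤ Q y ℤ.- c) ≡ b ℤ.* U
      slack≡bU = trans (cong (λ d → + 1 ℤ.- (ℤ.- d ℤ.- c)) (dotℤ-constantʳ Q y U y≡U)) (rearrange c (sumℤ Q))
    U*[1-Σt]≡1 : U ℤ.* (+ 1 ℤ.- sumℤ t) ≡ + 1
    U*[1-Σt]≡1 = begin
      U ℤ.* (+ 1 ℤ.- sumℤ t)     ≡⟨ distrib U (sumℤ t) ⟩
      U ℤ.* + 1 ℤ.- U ℤ.* sumℤ t ≡⟨ cong (λ s → U ℤ.* + 1 ℤ.- s) (dotℤ-constantʳ t y U y≡U) ⟨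
      U ℤ.* + 1 ℤ.- c            ≡⟨ cancel c ⟩
      + 1                        ∎
      where
      distrib : ∀ U s → U ℤ.* (+ 1 ℤ.- s) ≡ U ℤ.* + 1 ℤ.- U ℤ.* s
      distrib = solve-∀
      cancel : ∀ c → (+ 1 ℤ.+ c) ℤ.* + 1 ℤ.- c ≡ + 1
      cancel = solve-∀

  tight-facet⇒divides : (p : Fin n) → sumℤ t ≡ + 0 → + 0 ℤ.< Q p → Q p ℤ.≤ sumℤ Q →
    (∀ k → k ≢ p → y k ℤ.- c ≡ + 1) → ℤ.- dotℤ Q y ℤ.- c ≡ + 1 → y p ℤ.- c ℤ.≤ + 1 →
    ∃ λ K → b ≡ Q p ℤ.* K
  tight-facet⇒divides p Σt≡0 0<Qp Qp≤ΣQ tight zero-tight p-below = ℤ.- v , b≡Qp*[-v]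
    where
    open ≡-Reasoning
    v : ℤ
    v = y p ℤ.- U
    dotℤ-y : ∀ g → dotℤ g y ≡ U ℤ.* sumℤ g ℤ.+ v ℤ.* g p
    dotℤ-y g = dotℤ-constantʳ-except g y U p (λ k k≢p → i-j≡1⇒i≡1+j (tight k k≢p))

    c≡v*tp : c ≡ v ℤ.* t p
    c≡v*tp = begin
      c                                ≡⟨ dotℤ-y t ⟩
      U ℤ.* sumℤ t ℤ.+ v ℤ.* t p       ≡⟨ cong (λ s → U ℤ.* s ℤ.+ v ℤ.* t p) Σt≡0 ⟩
      U ℤ.* + 0 ℤ.+ v ℤ.* t p          ≡⟨ drop U (v ℤ.* t p) ⟩
      v ℤ.* t p                        ∎
      where
      drop : ∀ U x → U ℤ.* + 0 ℤ.+ x ≡ x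
      drop = solve-∀

    v*Qp≡-bU : v ℤ.* Q p ≡ ℤ.- (b ℤ.* U)
    v*Qp≡-bU = begin
      v ℤ.* Q p                                                   ≡⟨ isolate v (Q p) U (sumℤ Q) c ⟩
      ℤ.- (ℤ.- (U ℤ.* sumℤ Q ℤ.+ v ℤ.* Q p) ℤ.- c) ℤ.- c ℤ.- U ℤ.* sumℤ Q
        ≡⟨ cong (λ d → ℤ.- (ℤ.- d ℤ.- c) ℤ.- c ℤ.- U ℤ.* sumℤ Q) (dotℤ-y Q) ⟨
      ℤ.- (ℤ.- dotℤ Q y ℤ.- c) ℤ.- c ℤ.- U ℤ.* sumℤ Q
        ≡⟨ cong (λ e → ℤ.- e ℤ.- c ℤ.- U ℤ.* sumℤ Q) zero-tight ⟩
      ℤ.- + 1 ℤ.- c ℤ.- U ℤ.* sumℤ Q                              ≡⟨ collect c (sumℤ Q) ⟩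
      ℤ.- (b ℤ.* U)                                               ∎
      where
      isolate : ∀ v Q U S c → v ℤ.* Q ≡ ℤ.- (ℤ.- (U ℤ.* S ℤ.+ v ℤ.* Q) ℤ.- c) ℤ.- c ℤ.- U ℤ.* S
      isolate = solve-∀
      collect : ∀ c S → ℤ.- + 1 ℤ.- c ℤ.- (+ 1 ℤ.+ c) ℤ.* S ≡ ℤ.- ((+ 1 ℤ.+ S) ℤ.* (+ 1 ℤ.+ c))
      collect = solve-∀

    0≤-v : + 0 ℤ.≤ ℤ.- v
    0≤-v = subst (+ 0 ℤ.≤_) (complement (y p) c) (ℤP.i≤j⇒0≤j-i p-below)
      where
      complement : ∀ y c → + 1 ℤ.- (y ℤ.- c) ≡ ℤ.- (y ℤ.- (+ 1 ℤ.+ c))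
      complement = solve-∀

    Qp<b : Q p ℤ.< b
    Qp<b = ℤP.≤-<-trans Qp≤ΣQ (ℤP.suc[i]≤j⇒i<j ℤP.≤-refl)

    0≤U : + 0 ℤ.≤ U
    0≤U = 0≤i*j⇒0≤j (ℤP.<-trans 0<Qp Qp<b)
      (subst (+ 0 ℤ.≤_) (trans (neg-mult v (Q p)) (trans (cong ℤ.-_ v*Qp≡-bU) (ℤP.neg-involutive (b ℤ.* U))))
        (*-nonNegℤ 0≤-v (ℤP.<⇒≤ 0<Qp)))
      where
      neg-mult : ∀ v q → ℤ.- v ℤ.* q ≡ ℤ.- (v ℤ.* q)
      neg-mult = solve-∀

    U*[Qp+b*tp]≡Qp : U ℤ.* (Q p ℤ.+ b ℤ.* t p) ≡ Q p
    U*[Qp+b*tp]≡Qp = begin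
      U ℤ.* (Q p ℤ.+ b ℤ.* t p)                    ≡⟨ expand U (Q p) b (t p) ⟩
      U ℤ.* Q p ℤ.+ t p ℤ.* (b ℤ.* U)
        ≡⟨ cong (λ e → U ℤ.* Q p ℤ.+ t p ℤ.* e) (ℤP.neg-involutive (b ℤ.* U)) ⟨
      U ℤ.* Q p ℤ.+ t p ℤ.* ℤ.- ℤ.- (b ℤ.* U)      ≡⟨ cong (λ e → U ℤ.* Q p ℤ.+ t p ℤ.* ℤ.- e) v*Qp≡-bU ⟨
      U ℤ.* Q p ℤ.+ t p ℤ.* ℤ.- (v ℤ.* Q p)        ≡⟨ factor U (Q p) (t p) v ⟩
      Q p ℤ.* (U ℤ.- v ℤ.* t p)                    ≡⟨ cong (λ e → Q p ℤ.* (U ℤ.- e)) c≡v*tp ⟨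
      Q p ℤ.* (U ℤ.- c)                            ≡⟨ cancel (Q p) c ⟩
      Q p                                          ∎
      where
      expand : ∀ U Q b t → U ℤ.* (Q ℤ.+ b ℤ.* t) ≡ U ℤ.* Q ℤ.+ t ℤ.* (b ℤ.* U)
      expand = solve-∀
      factor : ∀ U Q t v → U ℤ.* Q ℤ.+ t ℤ.* ℤ.- (v ℤ.* Q) ≡ Q ℤ.* (U ℤ.- v ℤ.* t)
      factor = solve-∀
      cancel : ∀ Q c → Q ℤ.* ((+ 1 ℤ.+ c) ℤ.- c) ≡ Q
      cancel = solve-∀

    b≡Qp*[-v] : b ≡ Q p ℤ.* ℤ.- v
    b≡Qp*[-v] = begin
      b                     ≡⟨ ℤP.*-identityʳ b ⟨
      b ℤ.* + 1             ≡⟨ cong (b ℤ.*_) (multiplier≡1 (t p) 0≤U 0<Qp Qp<b U*[Qp+b*tp]≡Qp) ⟨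
      b ℤ.* U               ≡⟨ ℤP.neg-involutive (b ℤ.* U) ⟨
      ℤ.- ℤ.- (b ℤ.* U)     ≡⟨ cong ℤ.-_ v*Qp≡-bU ⟨
      ℤ.- (v ℤ.* Q p)       ≡⟨ swap v (Q p) ⟩
      Q p ℤ.* ℤ.- v         ∎
      where
      swap : ∀ v Q → ℤ.- (v ℤ.* Q) ≡ Q ℤ.* ℤ.- v
      swap = solve-∀

0≤r*x+a⇒-[a/r]≤x : ∀ w x a → + 0 ℤ.≤ + suc w ℤ.* x ℤ.+ + a → ℤ.- + (a ℕ./ suc w) ℤ.≤ x
0≤r*x+a⇒-[a/r]≤x w x a 0≤rx+a = ℤP.0≤i-j⇒j≤i (subst (+ 0 ℤ.≤_) (sym (minus-neg x ⌊a/r⌋)) 0≤x+⌊a/r⌋)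
  where
  r ⌊a/r⌋ a%r : ℤ
  r = + suc w
  ⌊a/r⌋ = + (a ℕ./ suc w)
  a%r = + (a ℕ.% suc w)
  minus-neg : ∀ x d → x ℤ.- ℤ.- d ≡ x ℤ.+ d
  minus-neg = solve-∀
  a≡a%r+r*⌊a/r⌋ : + a ≡ a%r ℤ.+ r ℤ.* ⌊a/r⌋
  a≡a%r+r*⌊a/r⌋ = trans (cong +_ (m≡m%n+[m/n]*n a (suc w)))
    (trans (ℤP.pos-+ (a ℕ.% suc w) _)
      (cong (λ s → a%r ℤ.+ s) (trans (ℤP.pos-* (a ℕ./ suc w) (suc w)) (ℤP.*-comm ⌊a/r⌋ r))))
  0≤r-[1+a%r] : + 0 ℤ.≤ r ℤ.- (+ 1 ℤ.+ a%r)
  0≤r-[1+a%r] = ℤP.i≤j⇒0≤j-i (ℤ.+≤+ (m%n<n a (suc w)))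
  r*[1+x+⌊a/r⌋]≡ : r ℤ.* (+ 1 ℤ.+ (x ℤ.+ ⌊a/r⌋)) ≡ + 1 ℤ.+ ((r ℤ.* x ℤ.+ + a) ℤ.+ (r ℤ.- (+ 1 ℤ.+ a%r)))
  r*[1+x+⌊a/r⌋]≡ = trans (expand r x ⌊a/r⌋ a%r)
    (cong (λ A → + 1 ℤ.+ ((r ℤ.* x ℤ.+ A) ℤ.+ (r ℤ.- (+ 1 ℤ.+ a%r)))) (sym a≡a%r+r*⌊a/r⌋))
    where
    expand : ∀ r x d m →
      r ℤ.* (+ 1 ℤ.+ (x ℤ.+ d)) ≡ + 1 ℤ.+ ((r ℤ.* x ℤ.+ (m ℤ.+ r ℤ.* d)) ℤ.+ (r ℤ.- (+ 1 ℤ.+ m)))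
    expand = solve-∀
  0<r*[1+x+⌊a/r⌋] : + 0 ℤ.< r ℤ.* (+ 1 ℤ.+ (x ℤ.+ ⌊a/r⌋))
  0<r*[1+x+⌊a/r⌋] = subst (+ 0 ℤ.<_) (sym r*[1+x+⌊a/r⌋]≡)
    (ℤP.suc[i]≤j⇒i<j (ℤP.+-monoʳ-≤ (+ 1) (ℤP.+-mono-≤ 0≤rx+a 0≤r-[1+a%r])))
  0≤x+⌊a/r⌋ : + 0 ℤ.≤ x ℤ.+ ⌊a/r⌋
  0≤x+⌊a/r⌋ = subst (+ 0 ℤ.≤_) (ℤP.pred-suc (x ℤ.+ ⌊a/r⌋))
    (ℤP.i<j⇒i≤pred[j] (ℤP.*-cancelˡ-<-nonNeg {+ 0} {+ 1 ℤ.+ (x ℤ.+ ⌊a/r⌋)} r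
      (subst (ℤ._< r ℤ.* (+ 1 ℤ.+ (x ℤ.+ ⌊a/r⌋))) (sym (ℤP.*-zeroʳ r)) 0<r*[1+x+⌊a/r⌋])))

-- The simplex Δ(1,q)

module Simplex (q : List ℕ) where

  n : ℕ
  n = length q

  V : Fin (suc n) → ℤVec n
  V = simplexV q

  Q : ℤVec n
  Q i = + lookup q i

  b : ℤ
  b = + 1 ℤ.+ sumℤ Q

  0≤ΣQ : + 0 ℤ.≤ sumℤ Q
  0≤ΣQ = sumℤ-nonNeg {f = Q} (λ i → ℤ.+≤+ ℕ.z≤n)

  0≤b : + 0 ℤ.≤ b
  0≤b = ℤP.≤-trans 0≤ΣQ (ℤP.i≤j+i (sumℤ Q) (+ 1))

  V-coordinate : (λs : Fin (suc n) → ℚ) (i : Fin n) →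
    sumℚ (λ j → λs j ℚ.* toℚVec (V j) i) ≡ λs (suc i) ℚ.- λs zero ℚ.* ι (Q i)
  V-coordinate λs i = begin
    λs zero ℚ.* ι (ℤ.- Q i) ℚ.+ sumℚ (λ k → λs (suc k) ℚ.* ι (δℤ k i))
      ≡⟨ cong₂ ℚ._+_ (cong (λs zero ℚ.*_) (ι-homo-neg (Q i)))
                     (Σℚ.sum-cong (λ k → cong (λs (suc k) ℚ.*_) (ι-δ k i))) ⟩
    λs zero ℚ.* ℚ.- ι (Q i) ℚ.+ sumℚ (λ k → λs (suc k) ℚ.* δℚ k i)
      ≡⟨ cong (λs zero ℚ.* ℚ.- ι (Q i) ℚ.+_) (Σℚ.sum-cong (λ k →
           trans (ℚP.*-comm (λs (suc k)) (δℚ k i)) (cong (ℚ._* λs (suc k)) (δℚ-sym k i)))) ⟩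
    λs zero ℚ.* ℚ.- ι (Q i) ℚ.+ sumℚ (λ k → δℚ i k ℚ.* λs (suc k))
      ≡⟨ cong (λs zero ℚ.* ℚ.- ι (Q i) ℚ.+_) (Σℚ.sum-δ i (λs ∘ suc)) ⟩
    λs zero ℚ.* ℚ.- ι (Q i) ℚ.+ λs (suc i)
      ≡⟨ swap (λs zero) (ι (Q i)) (λs (suc i)) ⟩
    λs (suc i) ℚ.- λs zero ℚ.* ι (Q i) ∎
    where
    open ≡-Reasoning
    open +-*-Solver
    swap : ∀ l₀ x l → l₀ ℚ.* ℚ.- x ℚ.+ l ≡ l ℚ.- l₀ ℚ.* x
    swap = solve 3 (λ l₀ x l → l₀ :* (:- x) :+ l := l :- l₀ :* x) refl

  record Barycentric (z : ℚVec n) : Set where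
    field
      λ₀          : ℚ
      λ⁺          : Fin n → ℚ
      λ₀≥0        : 0ℚ ℚ.≤ λ₀
      λ⁺≥0        : ∀ i → 0ℚ ℚ.≤ λ⁺ i
      coordinate  : ∀ i → z i ≡ λ⁺ i ℚ.- λ₀ ℚ.* ι (Q i)
      sum         : sumℚ z ≡ 1ℚ ℚ.- λ₀ ℚ.* ι b

  barycentric : ∀ {z} → InConv V z → Barycentric z
  barycentric {z} (λs , λs≥0 , Σλs≡1 , z≡) = record
    { λ₀ = λs zero ; λ⁺ = λs ∘ suc ; λ₀≥0 = λs≥0 zero ; λ⁺≥0 = λs≥0 ∘ suc
    ; coordinate = coordinate ; sum = Σz }
    where
    open +-*-Solver
    coordinate : ∀ i → z i ≡ λs (suc i) ℚ.- λs zero ℚ.* ι (Q i)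
    coordinate i = trans (z≡ i) (V-coordinate λs i)
    rearrange : ∀ l₀ s t → s ℚ.- l₀ ℚ.* t ≡ (1ℚ ℚ.- l₀ ℚ.* (1ℚ ℚ.+ t)) ℚ.+ ((l₀ ℚ.+ s) ℚ.- 1ℚ)
    rearrange = solve 3 (λ l₀ s t → s :- l₀ :* t := (con 1ℚ :- l₀ :* (con 1ℚ :+ t)) :+ ((l₀ :+ s) :- con 1ℚ)) refl
    Σz : sumℚ z ≡ 1ℚ ℚ.- λs zero ℚ.* ι b
    Σz = begin
      sumℚ z
        ≡⟨ Σℚ.sum-cong coordinate ⟩
      sumℚ (λ i → λs (suc i) ℚ.+ ℚ.- (λs zero ℚ.* ι (Q i)))
        ≡⟨ Σℚ.sum-+ (λs ∘ suc) (λ i → ℚ.- (λs zero ℚ.* ι (Q i))) ⟩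
      sumℚ (λs ∘ suc) ℚ.+ sumℚ (λ i → ℚ.- (λs zero ℚ.* ι (Q i)))
        ≡⟨ cong (sumℚ (λs ∘ suc) ℚ.+_) (trans (cong ℚ.-_ (Σℚ.*-distribˡ-sum (λs zero) (ι ∘ Q)))
                                              (Σℚ.-‿distrib-sum (λ i → λs zero ℚ.* ι (Q i)))) ⟨
      sumℚ (λs ∘ suc) ℚ.- λs zero ℚ.* sumℚ (ι ∘ Q)
        ≡⟨ rearrange (λs zero) (sumℚ (λs ∘ suc)) (sumℚ (ι ∘ Q)) ⟩
      (1ℚ ℚ.- λs zero ℚ.* (1ℚ ℚ.+ sumℚ (ι ∘ Q))) ℚ.+ (sumℚ λs ℚ.- 1ℚ)
        ≡⟨ cong₂ (λ u v → (1ℚ ℚ.- λs zero ℚ.* u) ℚ.+ (v ℚ.- 1ℚ))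
                 (sym (trans (ι-homo-+ (+ 1) (sumℤ Q)) (cong (1ℚ ℚ.+_) (ι-sum Q)))) Σλs≡1 ⟩
      (1ℚ ℚ.- λs zero ℚ.* ι b) ℚ.+ (1ℚ ℚ.- 1ℚ)
        ≡⟨ trans (cong ((1ℚ ℚ.- λs zero ℚ.* ι b) ℚ.+_) (ℚP.+-inverseʳ 1ℚ)) (ℚP.+-identityʳ _) ⟩
      1ℚ ℚ.- λs zero ℚ.* ι b ∎
      where open ≡-Reasoning

  height : ℤVec n → ℤ
  height x = + 1 ℤ.- sumℤ x

  -- For a lattice point x with barycentric coordinates λ₀, λ⁺, height x = b λ₀ and
  -- b x i + Q i · height x = b λ⁺ i; both are therefore nonnegative integers.
  module _ {x : ℤVec n} (x∈Δ : LatticePt V x) where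

    open Barycentric (barycentric x∈Δ)

    private
      ι-height : ι (height x) ≡ λ₀ ℚ.* ι b
      ι-height = begin
        ι (+ 1 ℤ.- sumℤ x)
          ≡⟨ trans (ι-homo-+ (+ 1) (ℤ.- sumℤ x)) (cong (1ℚ ℚ.+_) (ι-homo-neg (sumℤ x))) ⟩
        1ℚ ℚ.- ι (sumℤ x)               ≡⟨ cong (λ s → 1ℚ ℚ.- s) (trans (ι-sum x) sum) ⟩
        1ℚ ℚ.- (1ℚ ℚ.- λ₀ ℚ.* ι b)      ≡⟨ solve 1 (λ y → con 1ℚ :- (con 1ℚ :- y) := y) refl (λ₀ ℚ.* ι b) ⟩
        λ₀ ℚ.* ι b                      ∎
        where
        open ≡-Reasoning
        open +-*-Solver

    0≤height : + 0 ℤ.≤ height x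
    0≤height = ι-cancel-≤ (subst (0ℚ ℚ.≤_) (sym ι-height) (*-nonNegℚ λ₀≥0 (ι-mono-≤ 0≤b)))

    0≤b*x+Q*height : ∀ i → + 0 ℤ.≤ b ℤ.* x i ℤ.+ Q i ℤ.* height x
    0≤b*x+Q*height i = ι-cancel-≤ (subst (0ℚ ℚ.≤_) (sym weight) (*-nonNegℚ (ι-mono-≤ 0≤b) (λ⁺≥0 i)))
      where
      open +-*-Solver
      cancel : ∀ B l l₀ q → B ℚ.* (l ℚ.- l₀ ℚ.* q) ℚ.+ q ℚ.* (l₀ ℚ.* B) ≡ B ℚ.* l
      cancel = solve 4 (λ B l l₀ q → B :* (l :- l₀ :* q) :+ q :* (l₀ :* B) := B :* l) refl
      weight : ι (b ℤ.* x i ℤ.+ Q i ℤ.* height x) ≡ ι b ℚ.* λ⁺ i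
      weight = begin
        ι (b ℤ.* x i ℤ.+ Q i ℤ.* height x)
          ≡⟨ trans (ι-homo-+ (b ℤ.* x i) (Q i ℤ.* height x)) (cong₂ ℚ._+_ (ι-homo-* b (x i)) (ι-homo-* (Q i) (height x))) ⟩
        ι b ℚ.* ι (x i) ℚ.+ ι (Q i) ℚ.* ι (height x)
          ≡⟨ cong₂ (λ u v → ι b ℚ.* u ℚ.+ ι (Q i) ℚ.* v) (coordinate i) ι-height ⟩
        ι b ℚ.* (λ⁺ i ℚ.- λ₀ ℚ.* ι (Q i)) ℚ.+ ι (Q i) ℚ.* (λ₀ ℚ.* ι b)
          ≡⟨ cancel (ι b) (λ⁺ i) λ₀ (ι (Q i)) ⟩
        ι b ℚ.* λ⁺ i ∎
        where open ≡-Reasoning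

  module Facet (p : Fin n) where

    functional : ℚ → ℚ → ℚVec n
    functional α β i = α ℚ.+ β ℚ.* δℚ p i

    dot-functional : ∀ α β (z : ℚVec n) → dot z (functional α β) ≡ α ℚ.* sumℚ z ℚ.+ β ℚ.* z p
    dot-functional α β z = begin
      sumℚ (λ i → z i ℚ.* (α ℚ.+ β ℚ.* δℚ p i))
        ≡⟨ Σℚ.sum-cong (λ i → expand (z i) α β (δℚ p i)) ⟩
      sumℚ (λ i → α ℚ.* z i ℚ.+ β ℚ.* (δℚ p i ℚ.* z i))
        ≡⟨ Σℚ.sum-+ (λ i → α ℚ.* z i) (λ i → β ℚ.* (δℚ p i ℚ.* z i)) ⟩
      sumℚ (λ i → α ℚ.* z i) ℚ.+ sumℚ (λ i → β ℚ.* (δℚ p i ℚ.* z i))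
        ≡⟨ cong₂ ℚ._+_ (Σℚ.*-distribˡ-sum α z) (Σℚ.*-distribˡ-sum β (λ i → δℚ p i ℚ.* z i)) ⟨
      α ℚ.* sumℚ z ℚ.+ β ℚ.* sumℚ (λ i → δℚ p i ℚ.* z i)
        ≡⟨ cong (λ s → α ℚ.* sumℚ z ℚ.+ β ℚ.* s) (Σℚ.sum-δ p z) ⟩
      α ℚ.* sumℚ z ℚ.+ β ℚ.* z p ∎
      where
      open ≡-Reasoning
      open +-*-Solver
      expand : ∀ z α β d → z ℚ.* (α ℚ.+ β ℚ.* d) ≡ α ℚ.* z ℚ.+ β ℚ.* (d ℚ.* z)
      expand = solve 4 (λ z α β d → z :* (α :+ β :* d) := α :* z :+ β :* (d :* z)) refl

    dot-V-zero : ∀ α β → dot (toℚVec (V zero)) (functional α β) ≡ ℚ.- (α ℚ.* ι (sumℤ Q) ℚ.+ β ℚ.* ι (Q p))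
    dot-V-zero α β = begin
      dot (toℚVec (V zero)) (functional α β)
        ≡⟨ dot-functional α β (toℚVec (V zero)) ⟩
      α ℚ.* sumℚ (λ i → ι (ℤ.- Q i)) ℚ.+ β ℚ.* ι (ℤ.- Q p)
        ≡⟨ cong (λ s → α ℚ.* s ℚ.+ β ℚ.* ι (ℤ.- Q p))
                (trans (sym (ι-sum (λ i → ℤ.- Q i))) (cong ι (sym (Σℤ.-‿distrib-sum Q)))) ⟩
      α ℚ.* ι (ℤ.- sumℤ Q) ℚ.+ β ℚ.* ι (ℤ.- Q p)
        ≡⟨ cong₂ (λ s x → α ℚ.* s ℚ.+ β ℚ.* x) (ι-homo-neg (sumℤ Q)) (ι-homo-neg (Q p)) ⟩
      α ℚ.* ℚ.- ι (sumℤ Q) ℚ.+ β ℚ.* ℚ.- ι (Q p)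
        ≡⟨ pull-neg α β (ι (sumℤ Q)) (ι (Q p)) ⟩
      ℚ.- (α ℚ.* ι (sumℤ Q) ℚ.+ β ℚ.* ι (Q p)) ∎
      where
      open ≡-Reasoning
      open +-*-Solver
      pull-neg : ∀ α β s x → α ℚ.* ℚ.- s ℚ.+ β ℚ.* ℚ.- x ≡ ℚ.- (α ℚ.* s ℚ.+ β ℚ.* x)
      pull-neg = solve 4 (λ α β s x → α :* (:- s) :+ β :* (:- x) := :- (α :* s :+ β :* x)) refl

    dot-V-suc : ∀ α β k → dot (toℚVec (V (suc k))) (functional α β) ≡ α ℚ.+ β ℚ.* δℚ k p
    dot-V-suc α β k = begin
      dot (toℚVec (V (suc k))) (functional α β)
        ≡⟨ dot-functional α β (toℚVec (V (suc k))) ⟩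
      α ℚ.* sumℚ (λ i → ι (δℤ k i)) ℚ.+ β ℚ.* ι (δℤ k p)
        ≡⟨ cong₂ (λ s x → α ℚ.* s ℚ.+ β ℚ.* x) (trans (Σℚ.sum-cong (ι-δ k)) (Σℚ.sum-δ≈1# k)) (ι-δ k p) ⟩
      α ℚ.* 1ℚ ℚ.+ β ℚ.* δℚ k p
        ≡⟨ cong (ℚ._+ β ℚ.* δℚ k p) (ℚP.*-identityʳ α) ⟩
      α ℚ.+ β ℚ.* δℚ k p ∎
      where open ≡-Reasoning

    sum-bound : ∀ z → InConv V z → dot z (functional 1ℚ 0ℚ) ℚ.≤ 1ℚ
    sum-bound z z∈Δ = subst (ℚ._≤ 1ℚ) (sym value) (0≤q⇒p-q≤p (*-nonNegℚ λ₀≥0 (ι-mono-≤ 0≤b)))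
      where
      open Barycentric (barycentric z∈Δ)
      open +-*-Solver
      simplify : ∀ s x → 1ℚ ℚ.* s ℚ.+ 0ℚ ℚ.* x ≡ s
      simplify = solve 2 (λ s x → con 1ℚ :* s :+ con 0ℚ :* x := s) refl
      value : dot z (functional 1ℚ 0ℚ) ≡ 1ℚ ℚ.- λ₀ ℚ.* ι b
      value = trans (dot-functional 1ℚ 0ℚ z) (trans (simplify (sumℚ z) (z p)) sum)

    facet-bound : ∀ z → InConv V z → dot z (functional (ι (Q p)) (ℚ.- ι b)) ℚ.≤ ι (Q p)
    facet-bound z z∈Δ = subst (ℚ._≤ ι (Q p)) (sym value) (0≤q⇒p-q≤p (*-nonNegℚ (ι-mono-≤ 0≤b) (λ⁺≥0 p)))
      where
      open Barycentric (barycentric z∈Δ)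
      open +-*-Solver
      simplify : ∀ q B l₀ l → q ℚ.* (1ℚ ℚ.- l₀ ℚ.* B) ℚ.+ ℚ.- B ℚ.* (l ℚ.- l₀ ℚ.* q) ≡ q ℚ.- B ℚ.* l
      simplify = solve 4 (λ q B l₀ l → q :* (con 1ℚ :- l₀ :* B) :+ (:- B) :* (l :- l₀ :* q) := q :- B :* l) refl
      value : dot z (functional (ι (Q p)) (ℚ.- ι b)) ≡ ι (Q p) ℚ.- ι b ℚ.* λ⁺ p
      value = trans (dot-functional (ι (Q p)) (ℚ.- ι b) z)
        (trans (cong₂ (λ s x → ι (Q p) ℚ.* s ℚ.+ ℚ.- ι b ℚ.* x) sum (coordinate p))
               (simplify (ι (Q p)) (ι b) λ₀ (λ⁺ p)))

    scaled-e : ℚ → ℚVec n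
    scaled-e s i = s ℚ.* δℚ p i

    dot-scaled-e : ∀ s α β → dot (scaled-e s) (functional α β) ≡ s ℚ.* (α ℚ.+ β)
    dot-scaled-e s α β = begin
      dot (scaled-e s) (functional α β)
        ≡⟨ dot-functional α β (scaled-e s) ⟩
      α ℚ.* sumℚ (λ i → s ℚ.* δℚ p i) ℚ.+ β ℚ.* (s ℚ.* δℚ p p)
        ≡⟨ cong₂ (λ u x → α ℚ.* u ℚ.+ β ℚ.* (s ℚ.* x))
                 (trans (sym (Σℚ.*-distribˡ-sum s (δℚ p))) (cong (s ℚ.*_) (Σℚ.sum-δ≈1# p))) (δℚ-diag p) ⟩
      α ℚ.* (s ℚ.* 1ℚ) ℚ.+ β ℚ.* (s ℚ.* 1ℚ)
        ≡⟨ collect s α β ⟩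
      s ℚ.* (α ℚ.+ β) ∎
      where
      open ≡-Reasoning
      open +-*-Solver
      collect : ∀ s α β → α ℚ.* (s ℚ.* 1ℚ) ℚ.+ β ℚ.* (s ℚ.* 1ℚ) ≡ s ℚ.* (α ℚ.+ β)
      collect = solve 3 (λ s α β → α :* (s :* con 1ℚ) :+ β :* (s :* con 1ℚ) := s :* (α :+ β)) refl

    scaled-e-small : ∀ {s ε} → ℚ.∣ s ∣ ℚ.≤ ε → ∀ i → ℚ.∣ scaled-e s i ∣ ℚ.≤ ε
    scaled-e-small {s} ∣s∣≤ε i with does (p Fin.≟ i)
    ... | true  = subst (λ x → ℚ.∣ x ∣ ℚ.≤ _) (sym (ℚP.*-identityʳ s)) ∣s∣≤ε
    ... | false = subst (λ x → ℚ.∣ x ∣ ℚ.≤ _) (sym (ℚP.*-zeroʳ s)) (ℚP.≤-trans (ℚP.0≤∣p∣ s) ∣s∣≤ε)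

  module Reflexivity (t : ℤVec n) (interior : OriginInInterior (translate V t))
                     (polar-lattice : IsLatticePolytope (InPolar (translate V t))) (p : Fin n) where

    open Facet p

    W : Fin (suc n) → ℤVec n
    W = translate V t

    ε : ℚ
    ε = proj₁ interior

    0<ε : 0ℚ ℚ.< ε
    0<ε = proj₁ (proj₂ interior)

    scaled-e∈conv : ∀ {s} → ℚ.∣ s ∣ ℚ.≤ ε → InConv W (scaled-e s)
    scaled-e∈conv {s} ∣s∣≤ε = proj₂ (proj₂ interior) (scaled-e s) (scaled-e-small ∣s∣≤ε)

    dotℤ-W-zero : ∀ y → dotℤ (W zero) y ≡ ℤ.- dotℤ Q y ℤ.- dotℤ t y
    dotℤ-W-zero y = trans (dotℤ-translate V t zero y)
      (cong (ℤ._- dotℤ t y) (trans (Σℤ.sum-cong (λ i → sym (ℤP.neg-distribˡ-* (Q i) (y i))))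
                                   (sym (Σℤ.-‿distrib-sum (λ i → Q i ℤ.* y i)))))

    dotℤ-W-suc : ∀ k y → dotℤ (W (suc k)) y ≡ y k ℤ.- dotℤ t y
    dotℤ-W-suc k y = trans (dotℤ-translate V t (suc k) y) (cong (ℤ._- dotℤ t y) (Σℤ.sum-δ k y))

    ∣ε∣≤ε : ℚ.∣ ε ∣ ℚ.≤ ε
    ∣ε∣≤ε = ℚP.≤-reflexive (ℚP.0≤p⇒∣p∣≡p (ℚP.<⇒≤ 0<ε))

    translation-sum : sumℤ t ≡ + 0
    translation-sum = from-support (supporting-lattice-vector V t polar-lattice (functional 1ℚ 0ℚ) 1ℚ sum-bound
                                      (scaled-e ε) (scaled-e∈conv ∣ε∣≤ε) positive)
      where
      positive : 0ℚ ℚ.< dot (scaled-e ε) (functional 1ℚ 0ℚ)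
      positive = subst (0ℚ ℚ.<_)
        (sym (trans (dot-scaled-e ε 1ℚ 0ℚ) (trans (cong (ε ℚ.*_) (ℚP.+-identityʳ 1ℚ)) (ℚP.*-identityʳ ε)))) 0<ε
      from-support : SupportingLatticeVector V t (functional 1ℚ 0ℚ) 1ℚ → sumℤ t ≡ + 0
      from-support (y , y-below , y-tight) = translation-sum≡0 Q t y 0≤ΣQ tight below
        where
        tight : ∀ k → y k ℤ.- dotℤ t y ≡ + 1
        tight k = trans (sym (dotℤ-W-suc k y)) (y-tight (suc k) (trans (dot-V-suc 1ℚ 0ℚ k)
          (trans (cong (1ℚ ℚ.+_) (ℚP.*-zeroˡ (δℚ k p))) (ℚP.+-identityʳ 1ℚ))))
        below : ℤ.- dotℤ Q y ℤ.- dotℤ t y ℤ.≤ + 1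
        below = subst (ℤ._≤ + 1) (dotℤ-W-zero y) (y-below zero)

    module _ (0<Qp : + 0 ℤ.< Q p) where

      private
        Qp≤ΣQ : Q p ℤ.≤ sumℤ Q
        Qp≤ΣQ = ≤-sumℤ {f = Q} (λ i → ℤ.+≤+ ℕ.z≤n) p

        0<b-Qp : + 0 ℤ.< b ℤ.- Q p
        0<b-Qp = subst (+ 0 ℤ.<_) (reassociate (sumℤ Q) (Q p))
          (ℤP.<-≤-trans (ℤ.+<+ (ℕ.s≤s ℕ.z≤n)) (ℤP.i≤i+j (+ 1) _ {{ℤ.nonNegative (ℤP.i≤j⇒0≤j-i Qp≤ΣQ)}}))
          where
          reassociate : ∀ S q → + 1 ℤ.+ (S ℤ.- q) ≡ (+ 1 ℤ.+ S) ℤ.- q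
          reassociate = solve-∀

        positive : 0ℚ ℚ.< dot (scaled-e (ℚ.- ε)) (functional (ι (Q p)) (ℚ.- ι b))
        positive = subst (0ℚ ℚ.<_) (sym value)
          (ℚP.positive⁻¹ _ {{ℚP.pos*pos⇒pos ε {{ℚ.positive 0<ε}} _ {{ℚ.positive (ι-mono-< 0<b-Qp)}}}})
          where
          open +-*-Solver
          flip : ∀ e q B → ℚ.- e ℚ.* (q ℚ.+ ℚ.- B) ≡ e ℚ.* (B ℚ.+ ℚ.- q)
          flip = solve 3 (λ e q B → (:- e) :* (q :+ (:- B)) := e :* (B :+ (:- q))) refl
          value : dot (scaled-e (ℚ.- ε)) (functional (ι (Q p)) (ℚ.- ι b)) ≡ ε ℚ.* ι (b ℤ.- Q p)
          value = trans (dot-scaled-e (ℚ.- ε) (ι (Q p)) (ℚ.- ι b))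
            (trans (flip ε (ι (Q p)) (ι b))
              (cong (ε ℚ.*_) (sym (trans (ι-homo-+ b (ℤ.- Q p)) (cong (ι b ℚ.+_) (ι-homo-neg (Q p)))))))

        ∣-ε∣≤ε : ℚ.∣ ℚ.- ε ∣ ℚ.≤ ε
        ∣-ε∣≤ε = subst (ℚ._≤ ε) (sym (ℚP.∣-p∣≡∣p∣ ε)) ∣ε∣≤ε

      Q∣b : ∃ λ K → b ≡ Q p ℤ.* K
      Q∣b = from-support (supporting-lattice-vector V t polar-lattice (functional (ι (Q p)) (ℚ.- ι b)) (ι (Q p))
                           facet-bound (scaled-e (ℚ.- ε)) (scaled-e∈conv ∣-ε∣≤ε) positive)
        where
        from-support : SupportingLatticeVector V t (functional (ι (Q p)) (ℚ.- ι b)) (ι (Q p)) → ∃ λ K → b ≡ Q p ℤ.* K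
        from-support (y , y-below , y-tight) =
          tight-facet⇒divides Q t y p translation-sum 0<Qp Qp≤ΣQ tight zero-tight p-below
          where
          open +-*-Solver
          tight : ∀ k → k ≢ p → y k ℤ.- dotℤ t y ≡ + 1
          tight k k≢p = trans (sym (dotℤ-W-suc k y)) (y-tight (suc k) (trans (dot-V-suc (ι (Q p)) (ℚ.- ι b) k)
            (trans (cong (λ d → ι (Q p) ℚ.+ ℚ.- ι b ℚ.* d) (δℚ-≢ k≢p)) (drop (ι (Q p)) (ℚ.- ι b)))))
            where
            drop : ∀ x y → x ℚ.+ y ℚ.* 0ℚ ≡ x
            drop = solve 2 (λ x y → x :+ y :* con 0ℚ := x) refl
          zero-tight : ℤ.- dotℤ Q y ℤ.- dotℤ t y ≡ + 1
          zero-tight = trans (sym (dotℤ-W-zero y)) (y-tight zero (trans (dot-V-zero (ι (Q p)) (ℚ.- ι b))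
            (trans (cong (λ B → ℚ.- (ι (Q p) ℚ.* ι (sumℤ Q) ℚ.+ ℚ.- B ℚ.* ι (Q p))) (ι-homo-+ (+ 1) (sumℤ Q)))
                   (cancel (ι (Q p)) (ι (sumℤ Q))))))
            where
            cancel : ∀ q S → ℚ.- (q ℚ.* S ℚ.+ ℚ.- (1ℚ ℚ.+ S) ℚ.* q) ≡ q
            cancel = solve 2 (λ q S → :- (q :* S :+ (:- (con 1ℚ :+ S)) :* q) := q) refl
          p-below : y p ℤ.- dotℤ t y ℤ.≤ + 1
          p-below = subst (ℤ._≤ + 1) (dotℤ-W-suc p y) (y-below (suc p))

  reflexive⇒Q∣b : Reflexive V → ∀ p → + 0 ℤ.< Q p → ∃ λ K → b ≡ Q p ℤ.* K
  reflexive⇒Q∣b (t , interior , polar-lattice) p = Reflexivity.Q∣b t interior polar-lattice p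

-- The integer decomposition property

module IntegerDecomposition (q : List ℕ) (w : ℕ) (p : Fin (length q)) (qp≡1+w : lookup q p ≡ suc w)
                            (K : ℤ) (b≡rK : Simplex.b q ≡ + suc w ℤ.* K) where

  open Simplex q

  r : ℤ
  r = + suc w

  ⌊Q/r⌋ Q%r : ℤVec n
  ⌊Q/r⌋ i = + (lookup q i ℕ./ suc w)
  Q%r i = + (lookup q i ℕ.% suc w)

  D M : ℤ
  D = sumℤ ⌊Q/r⌋
  M = sumℤ Q%r

  Q≡Q%r+r*⌊Q/r⌋ : ∀ i → Q i ≡ Q%r i ℤ.+ r ℤ.* ⌊Q/r⌋ i
  Q≡Q%r+r*⌊Q/r⌋ i = trans (cong +_ (m≡m%n+[m/n]*n (lookup q i) (suc w)))
    (trans (ℤP.pos-+ (lookup q i ℕ.% suc w) _)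
      (cong (λ s → Q%r i ℤ.+ s) (trans (ℤP.pos-* (lookup q i ℕ./ suc w) (suc w)) (ℤP.*-comm (⌊Q/r⌋ i) r))))

  r*[K-D]≡1+M : r ℤ.* (K ℤ.- D) ≡ + 1 ℤ.+ M
  r*[K-D]≡1+M = begin
    r ℤ.* (K ℤ.- D)                      ≡⟨ distrib r K D ⟩
    r ℤ.* K ℤ.- r ℤ.* D                  ≡⟨ cong (ℤ._- r ℤ.* D) b≡rK ⟨
    b ℤ.- r ℤ.* D                        ≡⟨ cong (λ S → + 1 ℤ.+ S ℤ.- r ℤ.* D) ΣQ≡M+rD ⟩
    + 1 ℤ.+ (M ℤ.+ r ℤ.* D) ℤ.- r ℤ.* D  ≡⟨ cancel M (r ℤ.* D) ⟩
    + 1 ℤ.+ M                            ∎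
    where
    open ≡-Reasoning
    distrib : ∀ r K D → r ℤ.* (K ℤ.- D) ≡ r ℤ.* K ℤ.- r ℤ.* D
    distrib = solve-∀
    cancel : ∀ M E → + 1 ℤ.+ (M ℤ.+ E) ℤ.- E ≡ + 1 ℤ.+ M
    cancel = solve-∀
    ΣQ≡M+rD : sumℤ Q ≡ M ℤ.+ r ℤ.* D
    ΣQ≡M+rD = trans (Σℤ.sum-cong Q≡Q%r+r*⌊Q/r⌋)
      (trans (Σℤ.sum-+ Q%r (λ i → r ℤ.* ⌊Q/r⌋ i)) (cong (λ s → M ℤ.+ s) (sym (Σℤ.*-distribˡ-sum r ⌊Q/r⌋))))

  0<K-D : + 0 ℤ.< K ℤ.- D
  0<K-D = ℤP.*-cancelˡ-<-nonNeg {+ 0} {K ℤ.- D} r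
    (subst₂ ℤ._<_ (sym (ℤP.*-zeroʳ r)) (sym r*[K-D]≡1+M)
      (ℤP.suc[i]≤j⇒i<j (ℤP.+-monoʳ-≤ (+ 1) (sumℤ-nonNeg {f = Q%r} (λ i → ℤ.+≤+ ℕ.z≤n)))))

  H : ℕ
  H = ℤ.∣ K ℤ.- D ∣

  +H≡K-D : + H ≡ K ℤ.- D
  +H≡K-D = ℤP.0≤i⇒+∣i∣≡i (ℤP.<⇒≤ 0<K-D)

  1≤H : 1 ℕ.≤ H
  1≤H with subst (+ 0 ℤ.<_) (sym +H≡K-D) 0<K-D
  ... | ℤ.+<+ 0<H = 0<H

  floor-point : ℤVec n
  floor-point i = ℤ.- ⌊Q/r⌋ i

  -- The weights are 1/r on the vertex -q and (q_i mod r)/r on the vertex e_i.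
  floor-point∈cone : InCone V (+ H) floor-point
  floor-point∈cone = λs , λs≥0 , Σλs≡H , coordinate
    where
    open +-*-Solver
    instance
      ιr-positive : ℚ.Positive (ι r)
      ιr-positive = ℚ.positive (ι-mono-< {+ 0} {r} (ℤ.+<+ (ℕ.s≤s ℕ.z≤n)))
      ιr-nonZero : ℚ.NonZero (ι r)
      ιr-nonZero = ℚP.pos⇒nonZero (ι r)
    r⁻¹ : ℚ
    r⁻¹ = ℚ.1/ ι r
    r⁻¹*r≡1 : r⁻¹ ℚ.* ι r ≡ 1ℚ
    r⁻¹*r≡1 = ℚP.*-inverseˡ (ι r)
    0≤r⁻¹ : 0ℚ ℚ.≤ r⁻¹
    0≤r⁻¹ = ℚP.<⇒≤ (ℚP.positive⁻¹ r⁻¹ {{ℚP.1/pos⇒pos (ι r)}})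
    λs : Fin (suc n) → ℚ
    λs zero = r⁻¹
    λs (suc i) = ι (Q%r i) ℚ.* r⁻¹
    λs≥0 : ∀ j → 0ℚ ℚ.≤ λs j
    λs≥0 zero = 0≤r⁻¹
    λs≥0 (suc i) = *-nonNegℚ (ι-mono-≤ {+ 0} {Q%r i} (ℤ.+≤+ ℕ.z≤n)) 0≤r⁻¹
    Σλs≡H : sumℚ λs ≡ ι (+ H)
    Σλs≡H = begin
      r⁻¹ ℚ.+ sumℚ (λ i → ι (Q%r i) ℚ.* r⁻¹)
        ≡⟨ cong (r⁻¹ ℚ.+_) (trans (Σℚ.sum-cong (λ i → ℚP.*-comm (ι (Q%r i)) r⁻¹))
                                  (sym (Σℚ.*-distribˡ-sum r⁻¹ (ι ∘ Q%r)))) ⟩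
      r⁻¹ ℚ.+ r⁻¹ ℚ.* sumℚ (ι ∘ Q%r)
        ≡⟨ cong (λ s → r⁻¹ ℚ.+ r⁻¹ ℚ.* s) (sym (ι-sum Q%r)) ⟩
      r⁻¹ ℚ.+ r⁻¹ ℚ.* ι M
        ≡⟨ solve 2 (λ a m → a :+ a :* m := a :* (con 1ℚ :+ m)) refl r⁻¹ (ι M) ⟩
      r⁻¹ ℚ.* (1ℚ ℚ.+ ι M)
        ≡⟨ cong (r⁻¹ ℚ.*_) (trans (sym (ι-homo-+ (+ 1) M)) (cong ι (sym r*[K-D]≡1+M))) ⟩
      r⁻¹ ℚ.* ι (r ℤ.* (K ℤ.- D))
        ≡⟨ cong (r⁻¹ ℚ.*_) (ι-homo-* r (K ℤ.- D)) ⟩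
      r⁻¹ ℚ.* (ι r ℚ.* ι (K ℤ.- D))
        ≡⟨ trans (sym (ℚP.*-assoc r⁻¹ (ι r) _)) (trans (cong (ℚ._* ι (K ℤ.- D)) r⁻¹*r≡1) (ℚP.*-identityˡ _)) ⟩
      ι (K ℤ.- D)
        ≡⟨ cong ι +H≡K-D ⟨
      ι (+ H) ∎
      where open ≡-Reasoning
    coordinate : ∀ i → ι (floor-point i) ≡ sumℚ (λ j → λs j ℚ.* toℚVec (V j) i)
    coordinate i = sym (begin
      sumℚ (λ j → λs j ℚ.* toℚVec (V j) i)
        ≡⟨ V-coordinate λs i ⟩
      ι (Q%r i) ℚ.* r⁻¹ ℚ.- r⁻¹ ℚ.* ι (Q i)
        ≡⟨ cong (λ x → ι (Q%r i) ℚ.* r⁻¹ ℚ.- r⁻¹ ℚ.* x) (trans (cong ι (Q≡Q%r+r*⌊Q/r⌋ i))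
             (trans (ι-homo-+ (Q%r i) (r ℤ.* ⌊Q/r⌋ i)) (cong (ι (Q%r i) ℚ.+_) (ι-homo-* r (⌊Q/r⌋ i))))) ⟩
      ι (Q%r i) ℚ.* r⁻¹ ℚ.- r⁻¹ ℚ.* (ι (Q%r i) ℚ.+ ι r ℚ.* ι (⌊Q/r⌋ i))
        ≡⟨ solve 4 (λ m a R d → m :* a :- a :* (m :+ R :* d) := :- ((a :* R) :* d)) refl
                   (ι (Q%r i)) r⁻¹ (ι r) (ι (⌊Q/r⌋ i)) ⟩
      ℚ.- ((r⁻¹ ℚ.* ι r) ℚ.* ι (⌊Q/r⌋ i))
        ≡⟨ cong (λ x → ℚ.- (x ℚ.* ι (⌊Q/r⌋ i))) r⁻¹*r≡1 ⟩
      ℚ.- (1ℚ ℚ.* ι (⌊Q/r⌋ i))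
        ≡⟨ cong ℚ.-_ (ℚP.*-identityˡ _) ⟩
      ℚ.- ι (⌊Q/r⌋ i)
        ≡⟨ ι-homo-neg (⌊Q/r⌋ i) ⟨
      ι (floor-point i) ∎)
      where open ≡-Reasoning

  0<r : + 0 ℤ.< r
  0<r = ℤ.+<+ (ℕ.s≤s ℕ.z≤n)

  0<K : + 0 ℤ.< K
  0<K = ℤP.*-cancelˡ-<-nonNeg {+ 0} {K} r
    (subst₂ ℤ._<_ (sym (ℤP.*-zeroʳ r)) b≡rK (ℤP.suc[i]≤j⇒i<j (ℤP.+-monoʳ-≤ (+ 1) 0≤ΣQ)))

  K≤height : ∀ {x} → LatticePt V x → x p ℤ.< + 0 → K ℤ.≤ height x
  K≤height {x} x∈Δ xp<0 = ℤP.0≤i-j⇒j≤i (0≤i*j⇒0≤j 0<r (subst (+ 0 ℤ.≤_) weight≡r[h-K]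
    (ℤP.+-mono-≤ (0≤b*x+Q*height x∈Δ p) (*-nonNegℤ 0≤b (ℤP.neg-mono-≤ (ℤP.i<j⇒suc[i]≤j xp<0))))))
    where
    open ≡-Reasoning
    rearrange : ∀ r K x h → r ℤ.* K ℤ.* x ℤ.+ r ℤ.* h ℤ.+ r ℤ.* K ℤ.* ℤ.- (+ 1 ℤ.+ x) ≡ r ℤ.* (h ℤ.- K)
    rearrange = solve-∀
    weight≡r[h-K] : b ℤ.* x p ℤ.+ Q p ℤ.* height x ℤ.+ b ℤ.* ℤ.- (+ 1 ℤ.+ x p) ≡ r ℤ.* (height x ℤ.- K)
    weight≡r[h-K] = begin
      b ℤ.* x p ℤ.+ Q p ℤ.* height x ℤ.+ b ℤ.* ℤ.- (+ 1 ℤ.+ x p)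
        ≡⟨ cong₂ (λ B R → B ℤ.* x p ℤ.+ R ℤ.* height x ℤ.+ B ℤ.* ℤ.- (+ 1 ℤ.+ x p)) b≡rK (cong +_ qp≡1+w) ⟩
      r ℤ.* K ℤ.* x p ℤ.+ r ℤ.* height x ℤ.+ r ℤ.* K ℤ.* ℤ.- (+ 1 ℤ.+ x p)
        ≡⟨ rearrange r K (x p) (height x) ⟩
      r ℤ.* (height x ℤ.- K) ∎

  -⌊Q/r⌋≤x : ∀ {x} → LatticePt V x → height x ≡ K → ∀ i → ℤ.- ⌊Q/r⌋ i ℤ.≤ x i
  -⌊Q/r⌋≤x {x} x∈Δ h≡K i =
    0≤r*x+a⇒-[a/r]≤x w (x i) (lookup q i) (0≤i*j⇒0≤j 0<K (subst (+ 0 ℤ.≤_) weight≡K[rx+Q] (0≤b*x+Q*height x∈Δ i)))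
    where
    factor : ∀ r K x Q → r ℤ.* K ℤ.* x ℤ.+ Q ℤ.* K ≡ K ℤ.* (r ℤ.* x ℤ.+ Q)
    factor = solve-∀
    weight≡K[rx+Q] : b ℤ.* x i ℤ.+ Q i ℤ.* height x ≡ K ℤ.* (r ℤ.* x i ℤ.+ Q i)
    weight≡K[rx+Q] = trans (cong₂ (λ B h → B ℤ.* x i ℤ.+ Q i ℤ.* h) b≡rK h≡K) (factor r K (x i) (Q i))

  IDP⇒K-D≤1 : IDP V → K ℤ.- D ℤ.≤ + 1
  IDP⇒K-D≤1 idp = from-decomposition (idp H 1≤H floor-point floor-point∈cone)
    where
    from-decomposition : (Σ (Fin H → ℤVec n) λ xs → (∀ j → LatticePt V (xs j))
                                                  × (∀ i → floor-point i ≡ sumℤ (λ j → xs j i))) →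
                         K ℤ.- D ℤ.≤ + 1
    from-decomposition (xs , xs∈Δ , floor≡Σxs) = from-negative (sumℤ-neg⇒∃neg (λ j → xs j p) Σxs-p<0)
      where
      Σheight≡K : sumℤ (height ∘ xs) ≡ K
      Σheight≡K = begin
        sumℤ (λ j → + 1 ℤ.- sumℤ (xs j))
          ≡⟨ Σℤ.sum-+ (λ _ → + 1) (λ j → ℤ.- sumℤ (xs j)) ⟩
        sumℤ {H} (λ _ → + 1) ℤ.+ sumℤ (λ j → ℤ.- sumℤ (xs j))
          ≡⟨ cong₂ ℤ._+_ (sumℤ-const1 H) (sym (Σℤ.-‿distrib-sum (λ j → sumℤ (xs j)))) ⟩
        + H ℤ.- sumℤ (λ j → sumℤ (xs j))
          ≡⟨ cong (λ s → + H ℤ.- s)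
                  (trans (Σℤ.sum-comm (λ j i → xs j i)) (Σℤ.sum-cong (λ i → sym (floor≡Σxs i)))) ⟩
        + H ℤ.- sumℤ floor-point
          ≡⟨ cong₂ (λ h s → h ℤ.- s) +H≡K-D (sym (Σℤ.-‿distrib-sum ⌊Q/r⌋)) ⟩
        K ℤ.- D ℤ.- ℤ.- D
          ≡⟨ cancel K D ⟩
        K ∎
        where
        open ≡-Reasoning
        cancel : ∀ K D → K ℤ.- D ℤ.- ℤ.- D ≡ K
        cancel = solve-∀
      Σxs-p<0 : sumℤ (λ j → xs j p) ℤ.< + 0
      Σxs-p<0 = subst (ℤ._< + 0) (floor≡Σxs p)
        (subst (λ d → ℤ.- + d ℤ.< + 0) (sym (trans (cong (ℕ._/ suc w) qp≡1+w) (n/n≡1 (suc w)))) ℤ.-<+)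
      from-negative : ∃ (λ j → xs j p ℤ.< + 0) → K ℤ.- D ℤ.≤ + 1
      from-negative (j , xjp<0) = begin
        K ℤ.- D                        ≡⟨ ℤP.+-comm K (ℤ.- D) ⟩
        ℤ.- D ℤ.+ K                    ≤⟨ ℤP.+-monoˡ-≤ K -D≤Σx ⟩
        sumℤ (xs j) ℤ.+ K              ≡⟨ cong (λ h → sumℤ (xs j) ℤ.+ h) h≡K ⟨
        sumℤ (xs j) ℤ.+ height (xs j)  ≡⟨ cancel (sumℤ (xs j)) ⟩
        + 1                            ∎
        where
        open ℤP.≤-Reasoning
        cancel : ∀ s → s ℤ.+ (+ 1 ℤ.- s) ≡ + 1
        cancel = solve-∀
        h≡K : height (xs j) ≡ K
        h≡K = ℤP.≤-antisym (subst (height (xs j) ℤ.≤_) Σheight≡K (≤-sumℤ (λ j → 0≤height (xs∈Δ j)) j))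
                           (K≤height (xs∈Δ j) xjp<0)
        -D≤Σx : ℤ.- D ℤ.≤ sumℤ (xs j)
        -D≤Σx = subst (ℤ._≤ sumℤ (xs j)) (sym (Σℤ.-‿distrib-sum ⌊Q/r⌋))
          (sumℤ-mono-≤ (-⌊Q/r⌋≤x (xs∈Δ j) h≡K))

  IDP⇒sum-mod<r : IDP V → M ℤ.< r
  IDP⇒sum-mod<r idp = ℤP.suc[i]≤j⇒i<j
    (subst₂ ℤ._≤_ r*[K-D]≡1+M (ℤP.*-identityʳ r) (ℤP.*-monoˡ-≤-nonNeg r (IDP⇒K-D≤1 idp)))

-- Multiplicities

open import Data.Nat using (_≤_; _<_; _*_)
open import Data.Nat.ListAction using (sum)
open import Data.Nat.ListAction.Properties using (sum-++)

sumℤ-lookup : (g : ℕ → ℕ) (q : List ℕ) → sumℤ (λ i → + g (lookup q i)) ≡ + sum (map g q)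
sumℤ-lookup g []      = refl
sumℤ-lookup g (a ∷ q) = trans (cong (λ s → + g a ℤ.+ s) (sumℤ-lookup g q)) (sym (ℤP.pos-+ (g a) (sum (map g q))))

reflexiveIDP⇒sum-mod< : ∀ q → All (1 ≤_) q → ReflexiveIDP q → ∀ {v} → v ∈ q → sum (map (_mod v) q) < v
reflexiveIDP⇒sum-mod< q q>0 (reflexive , idp) v∈q =
  bound (Any.index v∈q) (All.lookup q>0 v∈q) (AnyP.lookup-index v∈q)
  where
  open Simplex q using (Q; b; reflexive⇒Q∣b)
  bound : ∀ p {v} → 1 ≤ v → v ≡ lookup q p → sum (map (_mod v) q) < v
  bound p {suc w} _ v≡qp = from-divisor (reflexive⇒Q∣b reflexive p (ℤ.+<+ (subst (1 ≤_) v≡qp (ℕ.s≤s ℕ.z≤n))))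
    where
    from-divisor : ∃ (λ K → b ≡ Q p ℤ.* K) → sum (map (ℕ._% suc w) q) < suc w
    from-divisor (K , b≡QpK) = ℤP.drop‿+<+ (subst (ℤ._< + suc w) (sumℤ-lookup (ℕ._% suc w) q)
      (IntegerDecomposition.IDP⇒sum-mod<r q w p (sym v≡qp) K (trans b≡QpK (cong (λ z → + z ℤ.* K) (sym v≡qp))) idp))

sum-map-replicate : (g : ℕ → ℕ) (k a : ℕ) → sum (map g (replicate k a)) ≡ k * g a
sum-map-replicate g zero    a = refl
sum-map-replicate g (suc k) a = cong (g a ℕ.+_) (sum-map-replicate g k a)

sum-map-≤-concat : ∀ {A : Set} (g : A → ℕ) {xs xss} → xs ∈ xss → sum (map g xs) ≤ sum (map g (concat xss))
sum-map-≤-concat g {xs} {ys ∷ xss} xs∈ = subst (sum (map g xs) ≤_) (sym split) (case xs∈)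
  where
  split : sum (map g (ys ++ concat xss)) ≡ sum (map g ys) ℕ.+ sum (map g (concat xss))
  split = trans (cong sum (map-++ g ys (concat xss))) (sum-++ (map g ys) (map g (concat xss)))
  case : xs ∈ ys ∷ xss → sum (map g xs) ≤ sum (map g ys) ℕ.+ sum (map g (concat xss))
  case (here refl) = ℕP.m≤m+n _ _
  case (there xs∈xss) = ℕP.≤-trans (sum-map-≤-concat g xs∈xss) (ℕP.m≤n+m _ _)

module _ {d : ℕ} (r x : Fin d → ℕ) where

  private
    block : Fin d → List ℕ
    block i = replicate (x i) (r i)

  qOf-positive : (∀ i → 1 ≤ r i) → All (1 ≤_) (qOf r x)
  qOf-positive r>0 = AllP.concat⁺ (AllP.map⁺ (AllP.tabulate⁺ (λ i → AllP.replicate⁺ (x i) (r>0 i))))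

  ∈-qOf : ∀ i → 1 ≤ x i → r i ∈ qOf r x
  ∈-qOf i x>0 = ∈-concat⁺′ (∈-replicate (x i) x>0) (∈-map⁺ block (∈-tabulate⁺ i))
    where
    ∈-replicate : ∀ k → 1 ≤ k → r i ∈ replicate k (r i)
    ∈-replicate (suc k) _ = here refl

  x*g[r]≤sum : ∀ (g : ℕ → ℕ) i → x i * g (r i) ≤ sum (map g (qOf r x))
  x*g[r]≤sum g i = subst (_≤ sum (map g (qOf r x))) (sum-map-replicate g (x i) (r i))
    (sum-map-≤-concat g (∈-map⁺ block (∈-tabulate⁺ i)))

a<b⇒a-mod-b≡a : ∀ {a b} → a < b → a mod b ≡ a
a<b⇒a-mod-b≡a {a} {suc b} a<b = m<n⇒m%n≡m a<b

¬b∣a⇒1≤a-mod-b : ∀ a b → 1 ≤ b → ¬ (b ∣ a) → 1 ≤ a mod b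
¬b∣a⇒1≤a-mod-b a (suc b) _ b∤a with a ℕ.% suc b in a%b≡
... | zero  = ⊥-elim (b∤a (m%n≡0⇒n∣m a (suc b) a%b≡))
... | suc _ = ℕ.s≤s ℕ.z≤n

r-monotone : ∀ {d} (r : Fin d → ℕ) → (∀ i j → toℕ i < toℕ j → r i < r j) →
             ∀ i j → toℕ i ≤ toℕ j → r i ≤ r j
r-monotone r r-increasing i j i≤j with ℕP.m≤n⇒m<n∨m≡n i≤j
... | inj₁ i<j = ℕP.<⇒≤ (r-increasing i j i<j)
... | inj₂ i≡j = ℕP.≤-reflexive (cong r (FinP.toℕ-injective i≡j))

module Multiplicities {e : ℕ} (r x : Fin (suc e) → ℕ) (r>0 : ∀ i → 1 ≤ r i)
                      (r-increasing : ∀ i j → toℕ i < toℕ j → r i < r j) (x>0 : ∀ i → 1 ≤ x i)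
                      (Δ-refl-IDP : ReflexiveIDP (qOf r x)) where

  x*[r-mod-r]<r : ∀ i j → x i * (r i mod r j) < r j
  x*[r-mod-r]<r i j = ℕP.≤-<-trans (x*g[r]≤sum r x (_mod r j) i)
    (reflexiveIDP⇒sum-mod< (qOf r x) (qOf-positive r x r>0) Δ-refl-IDP (∈-qOf r x j (x>0 j)))

  x*r<r-next : ∀ i j → toℕ i < toℕ j → x i * r i < r j
  x*r<r-next i j i<j = subst (λ m → x i * m < r j) (a<b⇒a-mod-b≡a (r-increasing i j i<j)) (x*[r-mod-r]<r i j)

  x*r≤r-succ : ∀ i (h : suc (toℕ i) < suc e) → x i * r i ≤ r (fromℕ< h)
  x*r≤r-succ i h = ℕP.<⇒≤ (x*r<r-next i (fromℕ< h) (subst (toℕ i <_) (sym (FinP.toℕ-fromℕ< h)) ℕP.≤-refl))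

  x-last*[r-last-mod-r]≤r : ∀ j → x (fromℕ e) * (r (fromℕ e) mod r j) ≤ r j
  x-last*[r-last-mod-r]≤r j = ℕP.<⇒≤ (x*[r-mod-r]<r (fromℕ e) j)

  x≤r-last : ∀ j → ¬ (r j ∣ r (fromℕ e)) → ∀ i → x i ≤ r (fromℕ e)
  x≤r-last j r_j∤r_e i with toℕ i ℕP.<? e
  ... | yes i<e = begin
    x i                   ≤⟨ ℕP.m≤m*n (x i) (r i) {{ℕ.>-nonZero (r>0 i)}} ⟩
    x i * r i             ≤⟨ x*r≤r-succ i (ℕ.s≤s i<e) ⟩
    r (fromℕ< (ℕ.s≤s i<e)) ≤⟨ r-monotone r r-increasing _ (fromℕ e) (FinP.≤fromℕ _) ⟩
    r (fromℕ e)           ∎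
    where open ℕP.≤-Reasoning
  ... | no i≮e = subst (λ k → x k ≤ r (fromℕ e)) (sym i≡last) (begin
    x (fromℕ e)                              ≤⟨ ℕP.m≤m*n (x (fromℕ e)) _ {{ℕ.>-nonZero r-mod>0}} ⟩
    x (fromℕ e) * (r (fromℕ e) mod r j)      ≤⟨ x-last*[r-last-mod-r]≤r j ⟩
    r j                                      ≤⟨ r-monotone r r-increasing j (fromℕ e) (FinP.≤fromℕ j) ⟩
    r (fromℕ e)                              ∎)
    where
    open ℕP.≤-Reasoning
    i≡last : i ≡ fromℕ e
    i≡last = FinP.toℕ-injective
      (ℕP.≤-antisym (FinP.≤fromℕ i) (subst (_≤ toℕ i) (sym (FinP.toℕ-fromℕ e)) (ℕP.≮⇒≥ i≮e)))
    r-mod>0 : 1 ≤ r (fromℕ e) mod r j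
    r-mod>0 = ¬b∣a⇒1≤a-mod-b (r (fromℕ e)) (r j) (r>0 j) r_j∤r_e

theorem3p6 : ((e : ℕ) → 1 ≤ e → (r x : Fin (suc e) → ℕ) →
      (∀ i → 1 ≤ r i) → (∀ i j → toℕ i < toℕ j → r i < r j) → (∀ i → 1 ≤ x i) →
      ReflexiveIDP (qOf r x) →
        ((i : Fin (suc e)) → (h : suc (toℕ i) < suc e) → x i * r i ≤ r (fromℕ< h))
        × ((j : Fin (suc e)) → toℕ j < e → ¬ (r j ∣ r (fromℕ e)) →
            x (fromℕ e) * (r (fromℕ e) mod r j) ≤ r j))
    × ((e : ℕ) → 1 ≤ e → (r : Fin (suc e) → ℕ) →
      (∀ i → 1 ≤ r i) → (∀ i j → toℕ i < toℕ j → r i < r j) →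
      Σ (Fin (suc e)) (λ j → toℕ j < e × ¬ (r j ∣ r (fromℕ e))) →
      Σ ℕ λ B → (x : Fin (suc e) → ℕ) → (∀ i → 1 ≤ x i) →
        ReflexiveIDP (qOf r x) → ∀ i → x i ≤ B)
theorem3p6 =
    (λ e _ r x r>0 r↑ x>0 Δ → let open Multiplicities r x r>0 r↑ x>0 Δ in
       x*r≤r-succ , λ j _ _ → x-last*[r-last-mod-r]≤r j)
  , (λ e _ r r>0 r↑ (j , _ , r_j∤r_e) →
       r (fromℕ e) , λ x x>0 Δ → Multiplicities.x≤r-last r x r>0 r↑ x>0 Δ j r_j∤r_e)
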